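{- For all $n \geq 1$, we have $\varphi \circ \Xi_{\mathrm{poset}} = \Xi_{\mathrm{bounce}}$ on $\mathcal{T}_n$, and $\varphi$ is a bijection from $\mathcal{P}_n$ to $\mathcal{D}_n$.
   Context: For a finite set $S = \{x_1 < \cdots < x_n\} \subset \mathbb{R}$, define the partial order $\preceq_S$ on $[n]$ by $i \prec_S j$ iff $x_i + 1 < x_j$. A unit interval poset is a poset isomorphic to some $([n], \preceq_S)$; $\mathcal{P}_n$ is the set of unit interval posets with $n$ elements (up to isomorphism). A Dyck path of size $n$ is a lattice path of $n$ north steps $(0,1)$ and $n$ east steps $(1,0)$ from $(0,0)$ to $(n,n)$ staying weakly above $y=x$; $\mathcal{D}_n$ is the set of these. A plane tree is a rooted tree with the children of each node ordered left to right; $\mathcal{T}_n$ is the set of plane trees with $n$ non-root nodes; the depth of a node is its distance to the root. $\Xi_{\mathrm{poset}}$: given $T \in \mathcal{T}_n$ with maximal arity $m$, for a non-root node $w$ let $c(w)=i$ if $w$ is the $i$-th child of its parent counted from right to left. For a non-root node $u$ of depth $d(u)$ with root-to-$u$ path $u_0, \ldots, u_{d(u)} = u$, set $x_u = d(u) + \sum_{i=1}^{d(u)} c(u_i)(m+2)^{ -i}$; with $S$ the set of all $x_u$, $\Xi_{\mathrm{poset}}(T) = ([n], \preceq_S)$. $\varphi$: given $P = ([n], \preceq_S)$, choose $S$ (possible without changing $\preceq_S$) with $S \cap S^+ = \varnothing$ where $S^+ = \{x+1 : x \in S\}$; write $S \cup S^+ = \{y_1 < \cdots < y_{2n}\}$;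 $\varphi(P)$ is the Dyck path whose $i$-th step is north if $y_i \in S$ and east otherwise (this does not depend on the choice of $S$). $\Xi_{\mathrm{bounce}}$: given $T \in \mathcal{T}_n$, let $\alpha_\ell$ be the number of nodes of depth $\ell$, $\ell_{\max}$ the maximal depth, and $s_\ell = \alpha_1 + \cdots + \alpha_\ell$. $\Xi_{\mathrm{bounce}}(T)$ is the Dyck path whose number of north steps on the line $x=0$ is the number of children of the root, and, for $1 \leq k \leq n-1$, writing uniquely $k = s_\ell - r$ with $1 \leq \ell \leq \ell_{\max}$ and $0 \leq r < \alpha_\ell$, whose number of north steps on the line $x = k$ is the number of children of the $(r+1)$-st node of depth $\ell$ counted from left to right.
   Formalization: The finite sets S defining $\preceq_S$, the unit interval posets and $\varphi$ are taken as subsets of ℚ rather than of ℝ. -}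

module Defs where

open import Data.Nat as ℕ using (ℕ; zero; suc; _≥_; _⊔_)
open import Data.Nat.Properties using (m^n≢0)
open import Data.Integer using (+_)
open import Data.Rational as ℚ using (ℚ; 0ℚ; 1ℚ)
open import Data.Rational.Properties as ℚP using (≤-decTotalOrder)
open import Data.List using (List; []; _∷_; _++_; length; map; concat; reverse;
  replicate; intercalate; lookup; foldr; filter)
open import Data.List.Relation.Unary.Linked using (Linked)
open import Data.List.Membership.Propositional using (_∈_; _∉_)
open import Data.List.Membership.DecPropositional ℚP._≟_ using (_∈?_)
import Data.List.Sort
open import Data.Fin using (Fin)
open import Data.Product using (Σ; _×_; _,_)
open import Data.Sum using (_⊎_)
open import Relation.Nullary using (yes; no)
open import Relation.Binary.PropositionalEquality using (_≡_)
open import Function.Bundles using (_↔_; Inverse; _⇔_)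

data PTree : Set where
  node : List PTree → PTree

-- number of non-root nodes
mutual
  size : PTree → ℕ
  size (node ts) = sizeF ts

  sizeF : List PTree → ℕ
  sizeF []       = 0
  sizeF (t ∷ ts) = suc (size t) ℕ.+ sizeF ts

mutual
  maxArity : PTree → ℕ
  maxArity (node ts) = length ts ⊔ maxArityF ts

  maxArityF : List PTree → ℕ
  maxArityF []       = 0
  maxArityF (t ∷ ts) = maxArity t ⊔ maxArityF ts

-- For every non-root node u (in preorder), the list [c(u_1), …, c(u_d)]
-- along the root-to-u path, where c(w) = i if w is the i-th child of its
-- parent counted from right to left.  The argument is the list for the
-- parent (reversed order of accumulation is avoided by appending).
mutual
  cPathsT : List ℕ → PTree → List (List ℕ)
  cPathsT p (node ts) = cPathsF p ts

  cPathsF : List ℕ → List PTree → List (List ℕ)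
  cPathsF p []       = []
  cPathsF p (t ∷ ts) =
    let q = p ++ (suc (length ts) ∷ []) in
    q ∷ cPathsT q t ++ cPathsF p ts

weightedSum : ℕ → ℕ → List ℕ → ℚ
weightedSum m i []       = 0ℚ
weightedSum m i (c ∷ cs) =
  ((+ c) ℚ./ (suc (suc m) ℕ.^ i)) {{m^n≢0 (suc (suc m)) i}}
    ℚ.+ weightedSum m (suc i) cs

xCoord : ℕ → List ℕ → ℚ
xCoord m cs = ((+ length cs) ℚ./ 1) ℚ.+ weightedSum m 1 cs

open Data.List.Sort ≤-decTotalOrder using (sort)

XiPosetSet : PTree → List ℚ
XiPosetSet T = sort (map (xCoord (maxArity T)) (cPathsT [] T))

-- Unit interval posets given by a finite set S ⊂ ℚ, S = {x_1 < … < x_n}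

StrictlyIncreasing : List ℚ → Set
StrictlyIncreasing S = Linked ℚ._<_ S

Leq : (S : List ℚ) → Fin (length S) → Fin (length S) → Set
Leq S i j = i ≡ j ⊎ (lookup S i ℚ.+ 1ℚ) ℚ.< lookup S j

PosetIso : List ℚ → List ℚ → Set
PosetIso S S' =
  Σ (Fin (length S) ↔ Fin (length S')) λ e →
    ∀ i j → Leq S i j ⇔ Leq S' (Inverse.to e i) (Inverse.to e j)

Good : List ℚ → Set
Good S = StrictlyIncreasing S × (∀ x → x ∈ S → (x ℚ.+ 1ℚ) ∉ S)

data Step : Set where
  N E : Step

countN countE : List Step → ℕ
countN []       = 0
countN (N ∷ w)  = suc (countN w)
countN (E ∷ w)  = countN w
countE []       = 0
countE (N ∷ w)  = countE w
countE (E ∷ w)  = suc (countE w)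

data AboveDiag : ℕ → ℕ → List Step → Set where
  done : ∀ {a b} → AboveDiag a b []
  stepN : ∀ {a b w} → AboveDiag (suc a) b w → AboveDiag a b (N ∷ w)
  stepE : ∀ {a b w} → suc b ℕ.≤ a → AboveDiag a (suc b) w → AboveDiag a b (E ∷ w)

IsDyck : ℕ → List Step → Set
IsDyck n w = countN w ≡ n × countE w ≡ n × AboveDiag 0 0 w

-- φ on a representative S with S ∩ S⁺ = ∅:
-- sort S ∪ S⁺ and read N for elements of S, E otherwise.

phiWord : List ℚ → List Step
phiWord S = map stepOf (sort (S ++ map (ℚ._+ 1ℚ) S))
  where
  stepOf : ℚ → Step
  stepOf y with y ∈? S
  ... | yes _ = N
  ... | no  _ = E

zipLevels : List (List ℕ) → List (List ℕ) → List (List ℕ)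
zipLevels []         ys         = ys
zipLevels (x ∷ xs)   []         = x ∷ xs
zipLevels (x ∷ xs)   (y ∷ ys)   = (x ++ y) ∷ zipLevels xs ys

mutual
  levelsT : PTree → List (List ℕ)
  levelsT (node ts) = (length ts ∷ []) ∷ levelsF ts

  levelsF : List PTree → List (List ℕ)
  levelsF []       = []
  levelsF (t ∷ ts) = zipLevels (levelsT t) (levelsF ts)

-- a_k = number of north steps on the line x = k, for k = 0, …, n:
-- a_0 = arity of the root; for k = s_ℓ - r the (r+1)-st node of depth ℓ
-- from the left, i.e. within each level the nodes are read right to left.
bounceCounts : PTree → List ℕ
bounceCounts T = concat (map reverse (levelsT T))

XiBounce : PTree → List Step
XiBounce T = intercalate (E ∷ []) (map (λ a → replicate a N) (bounceCounts T))

-- For S ∩ (S + 1) = ∅, the i-th north step of φ(S) lies in column d(x_i) = #{y ∈ S : y + 1 < x_i},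
-- the down-degree of x_i; as S is increasing, the elements below x_i are exactly the first d(x_i).
-- So φ(S) records the non-decreasing sequence of down-degrees, with d(x_i) < i: a Dyck path that
-- depends only on the isomorphism type (through the number of elements of each down-degree) and
-- determines the order (injectivity). Every Dyck path arises: on a rescaled integer grid, insert
-- repeatedly a new leftmost point lying below exactly the points of positive prescribed degree.
-- For a plane tree, x_u + 1 < x_v iff u comes weakly before the parent of v in the order in which
-- Ξ_bounce reads the nodes (by depth, right to left), so the number of nodes of down-degree k is the
-- number of children of the k-th node in that order, which is how Ξ_bounce is built.

module Submission where

open import Defs
open import Data.Nat as ℕ using (ℕ; zero; suc; _+_; _*_; _∸_; _^_; _≤_; _<_; _≥_; z≤n; s≤s; NonZero; _≡ᵇ_; _<ᵇ_; _⊔_; pred)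
import Data.Nat.Properties as ℕP
open import Data.Nat.Tactic.RingSolver using (solve-∀)
open import Data.Bool using (Bool; true; false; if_then_else_; _∨_; _∧_; T)
open import Data.Bool.Properties using (T-≡; ∨-assoc; ∨-identityʳ; ∧-distribˡ-∨)
import Data.Integer as ℤ
import Data.Integer.Properties as ℤP
open import Data.Rational as ℚ using (ℚ; 0ℚ; 1ℚ; toℚᵘ)
import Data.Rational.Properties as ℚP
open import Data.Rational.Unnormalised as ℚᵘ using (mkℚᵘ)
import Data.Rational.Unnormalised.Properties as ℚᵘP
open import Data.List as List using (List; []; _∷_; _++_; length; map; concat; reverse; replicate; intercalate; lookup; zip)
import Data.List.Properties as List
open import Data.List.Relation.Unary.Linked as Linked using (Linked; []; [-]; _∷_)
import Data.List.Relation.Unary.Linked.Properties as Linked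
open import Data.List.Relation.Unary.All as All using (All; []; _∷_)
import Data.List.Relation.Unary.All.Properties as All
open import Data.List.Relation.Unary.Any using (here; there)
open import Data.List.Relation.Unary.AllPairs as AllPairs using (AllPairs; []; _∷_)
import Data.List.Relation.Unary.AllPairs.Properties as AllPairs
import Data.List.Relation.Unary.Sorted.TotalOrder.Properties as Sorted
import Data.List.Relation.Binary.Pointwise as Pointwise
open import Data.List.Membership.Propositional using (_∈_; _∉_)
import Data.List.Membership.Propositional.Properties as ∈
open import Data.List.Membership.DecPropositional ℚP._≟_ using (_∈?_)
open import Data.List.Relation.Binary.Permutation.Propositional as ↭ using (_↭_; ↭-sym; ↭-trans; prep)
import Data.List.Relation.Binary.Permutation.Propositional.Properties as ↭
import Data.List.Relation.Binary.Permutation.Homogeneous as ↭ₕ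
open import Data.List.Sort ℚP.≤-decTotalOrder using (sort; sort-↭; sort-↗)
open import Data.Fin as Fin using (Fin; zero; suc; toℕ; cast)
import Data.Fin.Properties as Fin
open import Data.Fin.Permutation using (↔⇒≡; cast-id)
open import Data.Maybe using (Maybe; just; nothing)
open import Data.Maybe.Properties using (just-injective)
open import Data.Product using (Σ; _×_; _,_; proj₁; proj₂)
open import Data.Sum using (_⊎_; inj₁; inj₂)
open import Data.Empty using (⊥; ⊥-elim)
open import Data.Unit using (⊤; tt)
open import Relation.Binary using (DecTotalOrder; tri<; tri≈; tri>)
open import Relation.Nullary using (¬_; Dec; yes; no; does)
open import Relation.Nullary.Decidable using (dec-true; dec-false)
open import Relation.Binary.PropositionalEquality using (_≡_; _≢_; refl; sym; trans; cong; cong₂; subst; subst₂; module ≡-Reasoning)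
open import Function using (_∘_; id; case_of_)
open import Function.Bundles using (_↔_; Inverse; _⇔_; mk⇔; Equivalence)
import Algebra.Properties.CommutativeMonoid.Sum ℕP.+-0-commutativeMonoid as Sum

-- Rationals with known denominators

-- Represents x a d : x = a / d  (mkℚᵘ stores the denominator minus one).
Represents : ℚ → ℕ → ℕ → Set
Represents x a d = toℚᵘ x ℚᵘ.≃ mkℚᵘ (ℤ.+ a) (pred d)

fraction : ℕ → (d : ℕ) → .{{_ : NonZero d}} → ℚ
fraction a d = (ℤ.+ a) ℚ./ d

represents-fraction : ∀ a d .{{_ : NonZero d}} → Represents (fraction a d) a d
represents-fraction a (suc k) = ℚP.toℚᵘ-fromℚᵘ (mkℚᵘ (ℤ.+ a) k)

represents-1 : Represents 1ℚ 1 1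
represents-1 = ℚᵘP.≃-refl

represents-0 : Represents 0ℚ 0 1
represents-0 = ℚᵘP.≃-refl

pos-*-pos : ∀ a b → (ℤ.+ a) ℤ.* (ℤ.+ b) ≡ ℤ.+ (a * b)
pos-*-pos a b = sym (ℤP.pos-* a b)

represents-rescale : ∀ {x a b} d e .{{_ : NonZero d}} .{{_ : NonZero e}} →
  Represents x a d → a * e ≡ b * d → Represents x b e
represents-rescale {x} {a} {b} (suc k) (suc l) r eq =
  ℚᵘP.≃-trans r (ℚᵘ.*≡* (trans (pos-*-pos a (suc l)) (trans (cong ℤ.+_ eq) (sym (pos-*-pos b (suc k))))))

represents-+ : ∀ {x y a b} d e .{{_ : NonZero d}} .{{_ : NonZero e}} →
  Represents x a d → Represents y b e → Represents (x ℚ.+ y) (a * e + b * d) (d * e)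
represents-+ {x} {y} {a} {b} (suc k) (suc l) r s =
  ℚᵘP.≃-trans (ℚP.toℚᵘ-homo-+ x y) (ℚᵘP.≃-trans (ℚᵘP.+-cong r s)
    (ℚᵘP.≃-reflexive (cong (λ z → mkℚᵘ z (l + k * suc l)) eqn)))
  where
  eqn : (ℤ.+ a) ℤ.* (ℤ.+ suc l) ℤ.+ (ℤ.+ b) ℤ.* (ℤ.+ suc k) ≡ ℤ.+ (a * suc l + b * suc k)
  eqn = trans (cong₂ ℤ._+_ (pos-*-pos a (suc l)) (pos-*-pos b (suc k))) (sym (ℤP.pos-+ (a * suc l) (b * suc k)))

represents-< : ∀ {x y a b} d e .{{_ : NonZero d}} .{{_ : NonZero e}} →
  Represents x a d → Represents y b e → x ℚ.< y → a * e < b * d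
represents-< {x} {y} {a} {b} (suc k) (suc l) r s lt
  with ℚᵘP.<-respˡ-≃ r (ℚᵘP.<-respʳ-≃ s (ℚP.toℚᵘ-mono-< lt))
... | ℚᵘ.*<* h = ℤP.drop‿+<+ (subst₂ ℤ._<_ (pos-*-pos a (suc l)) (pos-*-pos b (suc k)) h)

represents-<⁻ : ∀ {x y a b} d e .{{_ : NonZero d}} .{{_ : NonZero e}} →
  Represents x a d → Represents y b e → a * e < b * d → x ℚ.< y
represents-<⁻ {x} {y} {a} {b} (suc k) (suc l) r s lt =
  ℚP.toℚᵘ-cancel-< (ℚᵘP.<-respˡ-≃ (ℚᵘP.≃-sym r) (ℚᵘP.<-respʳ-≃ (ℚᵘP.≃-sym s)
    (ℚᵘ.*<* (subst₂ ℤ._<_ (sym (pos-*-pos a (suc l))) (sym (pos-*-pos b (suc k))) (ℤ.+<+ lt)))))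

indicator : Bool → ℕ
indicator true = 1
indicator false = 0

count : ∀ {A : Set} → (A → Bool) → List A → ℕ
count p [] = 0
count p (x ∷ xs) = indicator (p x) + count p xs

countFin : (n : ℕ) → (Fin n → Bool) → ℕ
countFin n p = Sum.sum {n} (λ i → indicator (p i))

countFin-lookup : ∀ {A : Set} (p : A → Bool) (S : List A) → countFin (length S) (λ i → p (lookup S i)) ≡ count p S
countFin-lookup p [] = refl
countFin-lookup p (x ∷ S) = cong (_+_ (indicator (p x))) (countFin-lookup p S)

countFin-cong : ∀ n {p q : Fin n → Bool} → (∀ i → p i ≡ q i) → countFin n p ≡ countFin n q
countFin-cong n eq = Sum.sum-cong-≗ (λ i → cong indicator (eq i))

countFin-permute : ∀ {m n} (e : Fin m ↔ Fin n) (p : Fin n → Bool) → countFin m (λ i → p (Inverse.to e i)) ≡ countFin n p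
countFin-permute e p = sym (Sum.sum-permute (λ i → indicator (p i)) e)

count-cong : ∀ {A : Set} {p q : A → Bool} (xs : List A) → (∀ x → x ∈ xs → p x ≡ q x) → count p xs ≡ count q xs
count-cong [] h = refl
count-cong (x ∷ xs) h = cong₂ _+_ (cong indicator (h x (here refl))) (count-cong xs (λ y y∈ → h y (there y∈)))

count-map : ∀ {A B : Set} (p : B → Bool) (f : A → B) (xs : List A) → count p (map f xs) ≡ count (p ∘ f) xs
count-map p f [] = refl
count-map p f (x ∷ xs) = cong (_+_ (indicator (p (f x)))) (count-map p f xs)

count-++ : ∀ {A : Set} (p : A → Bool) (xs ys : List A) → count p (xs ++ ys) ≡ count p xs + count p ys
count-++ p [] ys = refl
count-++ p (x ∷ xs) ys = trans (cong (_+_ (indicator (p x))) (count-++ p xs ys)) (sym (ℕP.+-assoc (indicator (p x)) _ _))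

count-↭ : ∀ {A : Set} (p : A → Bool) {xs ys : List A} → xs ↭ ys → count p xs ≡ count p ys
count-↭ p ↭.refl = refl
count-↭ p (↭.prep x r) = cong (_+_ (indicator (p x))) (count-↭ p r)
count-↭ p (↭.swap x y r) = trans (sym (ℕP.+-assoc (indicator (p x)) (indicator (p y)) _))
  (trans (cong₂ _+_ (ℕP.+-comm (indicator (p x)) (indicator (p y))) (count-↭ p r)) (ℕP.+-assoc (indicator (p y)) (indicator (p x)) _))
count-↭ p (↭.trans r s) = trans (count-↭ p r) (count-↭ p s)

count-none : ∀ {A : Set} (p : A → Bool) (xs : List A) → (∀ x → x ∈ xs → p x ≡ false) → count p xs ≡ 0
count-none p [] h = refl
count-none p (x ∷ xs) h rewrite h x (here refl) = count-none p xs (λ y y∈ → h y (there y∈))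

count≡0⇒false : ∀ {A : Set} (p : A → Bool) (xs : List A) → count p xs ≡ 0 → ∀ x → x ∈ xs → p x ≡ false
count≡0⇒false p (y ∷ xs) h x (here refl) with p x
... | false = refl
count≡0⇒false p (y ∷ xs) h x (there x∈) with p y
... | false = count≡0⇒false p xs h x x∈

count-mono : ∀ {A : Set} {p q : A → Bool} (xs : List A) → (∀ x → p x ≡ true → q x ≡ true) → count p xs ≤ count q xs
count-mono [] h = z≤n
count-mono {p = p} {q} (x ∷ xs) h with p x in eq
... | true rewrite h x eq = s≤s (count-mono xs h)
... | false = ℕP.+-mono-≤ z≤n (count-mono xs h)

bool-ext : ∀ {a b : Bool} → (a ≡ true → b ≡ true) → (b ≡ true → a ≡ true) → a ≡ b
bool-ext {true} {true} f g = refl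
bool-ext {true} {false} f g = sym (f refl)
bool-ext {false} {true} f g = g refl
bool-ext {false} {false} f g = refl

does-sound : ∀ {P : Set} (d : Dec P) → does d ≡ true → P
does-sound (yes p) _ = p

countFin-false : ∀ n → countFin n (λ _ → false) ≡ 0
countFin-false zero = refl
countFin-false (suc n) = countFin-false n

countFin-downClosed : ∀ n (p : Fin n → Bool) → (∀ i j → toℕ i ≤ toℕ j → p j ≡ true → p i ≡ true) →
  ∀ i → (p i ≡ true) ⇔ (toℕ i < countFin n p)
countFin-downClosed (suc n) p closed i with p zero in p0
... | false = mk⇔ (λ pi → case trans (sym p0) (closed zero i z≤n pi) of λ ())
                  (λ lt → ⊥-elim (ℕP.n≮0 (ℕP.<-≤-trans lt (ℕP.≤-reflexive none))))
  where
  allFalse : ∀ j → p j ≡ false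
  allFalse j with p j in pj
  ... | true = case trans (sym p0) (closed zero j z≤n pj) of λ ()
  ... | false = refl
  none : countFin n (p ∘ suc) ≡ 0
  none = trans (countFin-cong n (allFalse ∘ suc)) (countFin-false n)
countFin-downClosed (suc n) p closed zero | true = mk⇔ (λ _ → s≤s z≤n) (λ _ → p0)
countFin-downClosed (suc n) p closed (suc i) | true =
  mk⇔ (λ pi → s≤s (Equivalence.to (IH i) pi)) (λ { (s≤s lt) → Equivalence.from (IH i) lt })
  where
  IH : ∀ i → (p (suc i) ≡ true) ⇔ (toℕ i < countFin n (p ∘ suc))
  IH = countFin-downClosed n (p ∘ suc) (λ a b le → closed (suc a) (suc b) (s≤s le))


-- Lattice paths with prescribed north-step columns

pathFrom : ℕ → List ℕ → ℕ → List Step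
pathFrom e [] m = replicate (m ∸ e) E
pathFrom e (b ∷ bs) m = replicate (b ∸ e) E ++ N ∷ pathFrom b bs m

northColumns : ℕ → List Step → List ℕ
northColumns e [] = []
northColumns e (N ∷ w) = e ∷ northColumns e w
northColumns e (E ∷ w) = northColumns (suc e) w

-- The i-th column is at most a + i: the path stays above the diagonal.
Bounded : ℕ → List ℕ → Set
Bounded a [] = ⊤
Bounded a (b ∷ bs) = b ≤ a × Bounded (suc a) bs

range : ℕ → ℕ → List ℕ
range e zero = []
range e (suc k) = e ∷ range (suc e) k

runs : List ℕ → List ℕ → List (List Step)
runs bs js = map (λ j → replicate (count (λ b → b ≡ᵇ j) bs) N) js

joinE : List (List Step) → List Step
joinE = intercalate (E ∷ [])

∸-suc : ∀ m e → suc e ≤ m → m ∸ e ≡ suc (m ∸ suc e)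
∸-suc m e le = ℕP.+-∸-assoc 1 le

≡ᵇ-refl : ∀ e → (e ≡ᵇ e) ≡ true
≡ᵇ-refl zero = refl
≡ᵇ-refl (suc e) = ≡ᵇ-refl e

≡ᵇ-false : ∀ a b → a ≢ b → (a ≡ᵇ b) ≡ false
≡ᵇ-false zero zero ne = ⊥-elim (ne refl)
≡ᵇ-false zero (suc b) ne = refl
≡ᵇ-false (suc a) zero ne = refl
≡ᵇ-false (suc a) (suc b) ne = ≡ᵇ-false a b (λ eq → ne (cong suc eq))

≡ᵇ-sound : ∀ a b → (a ≡ᵇ b) ≡ true → a ≡ b
≡ᵇ-sound a b eq = ℕP.≡ᵇ⇒≡ a b (subst T (sym eq) tt)

northColumns-Es++ : ∀ k e w → northColumns e (replicate k E ++ w) ≡ northColumns (k + e) w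
northColumns-Es++ zero e w = refl
northColumns-Es++ (suc k) e w = trans (northColumns-Es++ k (suc e) w) (cong (λ z → northColumns z w) (ℕP.+-suc k e))

northColumns-Es : ∀ k e → northColumns e (replicate k E) ≡ []
northColumns-Es zero e = refl
northColumns-Es (suc k) e = northColumns-Es k (suc e)

northColumns-pathFrom : ∀ e bs m → Linked _≤_ (e ∷ bs) → northColumns e (pathFrom e bs m) ≡ bs
northColumns-pathFrom e [] m L = northColumns-Es (m ∸ e) e
northColumns-pathFrom e (b ∷ bs) m (e≤b ∷ L) =
  trans (northColumns-Es++ (b ∸ e) e (N ∷ pathFrom b bs m))
   (trans (cong (λ z → z ∷ northColumns z (pathFrom b bs m)) (ℕP.m∸n+n≡m e≤b))
          (cong (b ∷_) (northColumns-pathFrom b bs m L)))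

pathFrom-E∷ : ∀ e bs m → All (λ b → suc e ≤ b) bs → suc e ≤ m → pathFrom e bs m ≡ E ∷ pathFrom (suc e) bs m
pathFrom-E∷ e [] m A le rewrite ∸-suc m e le = refl
pathFrom-E∷ e (b ∷ bs) m (h ∷ A) le rewrite ∸-suc b e h = refl

northColumns-≥ : ∀ e w → All (λ b → e ≤ b) (northColumns e w)
northColumns-≥ e [] = []
northColumns-≥ e (N ∷ w) = ℕP.≤-refl ∷ northColumns-≥ e w
northColumns-≥ e (E ∷ w) = All.map (λ le → ℕP.≤-trans (ℕP.n≤1+n e) le) (northColumns-≥ (suc e) w)

northColumns-sorted : ∀ e w → Linked _≤_ (e ∷ northColumns e w)
northColumns-sorted e [] = [-]
northColumns-sorted e (N ∷ w) = ℕP.≤-refl ∷ northColumns-sorted e w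
northColumns-sorted e (E ∷ w) = weak (northColumns-sorted (suc e) w)
  where
  weak : ∀ {xs} → Linked _≤_ (suc e ∷ xs) → Linked _≤_ (e ∷ xs)
  weak [-] = [-]
  weak (h ∷ L) = ℕP.≤-trans (ℕP.n≤1+n e) h ∷ L

pathFrom-northColumns : ∀ e w m → countE w + e ≡ m → pathFrom e (northColumns e w) m ≡ w
pathFrom-northColumns e [] m eq rewrite sym eq = cong (λ z → replicate z E) (ℕP.n∸n≡0 e)
pathFrom-northColumns e (N ∷ w) m eq rewrite ℕP.n∸n≡0 e = cong (N ∷_) (pathFrom-northColumns e w m eq)
pathFrom-northColumns e (E ∷ w) m eq =
  trans (pathFrom-E∷ e (northColumns (suc e) w) m (northColumns-≥ (suc e) w) le)
        (cong (E ∷_) (pathFrom-northColumns (suc e) w m (trans (ℕP.+-suc (countE w) e) eq)))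
  where
  le : suc e ≤ m
  le = subst (suc e ≤_) eq (s≤s (ℕP.m≤n+m e (countE w)))

length-northColumns : ∀ e w → length (northColumns e w) ≡ countN w
length-northColumns e [] = refl
length-northColumns e (N ∷ w) = cong suc (length-northColumns e w)
length-northColumns e (E ∷ w) = length-northColumns (suc e) w

northColumns-bounded : ∀ a e w → e ≤ a → AboveDiag a e w → Bounded a (northColumns e w)
northColumns-bounded a e [] le ad = tt
northColumns-bounded a e (N ∷ w) le (stepN ad) = le , northColumns-bounded (suc a) e w (ℕP.≤-trans le (ℕP.n≤1+n a)) ad
northColumns-bounded a e (E ∷ w) le (stepE lt ad) = northColumns-bounded a (suc e) w lt ad

countN-Es++ : ∀ k w → countN (replicate k E ++ w) ≡ countN w
countN-Es++ zero w = refl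
countN-Es++ (suc k) w = countN-Es++ k w

countE-Es++ : ∀ k w → countE (replicate k E ++ w) ≡ k + countE w
countE-Es++ zero w = refl
countE-Es++ (suc k) w = cong suc (countE-Es++ k w)

countE-Es : ∀ k → countE (replicate k E) ≡ k
countE-Es zero = refl
countE-Es (suc k) = cong suc (countE-Es k)

countN-Es : ∀ k → countN (replicate k E) ≡ 0
countN-Es zero = refl
countN-Es (suc k) = countN-Es k

countN-pathFrom : ∀ e bs m → countN (pathFrom e bs m) ≡ length bs
countN-pathFrom e [] m = countN-Es (m ∸ e)
countN-pathFrom e (b ∷ bs) m = trans (countN-Es++ (b ∸ e) _) (cong suc (countN-pathFrom b bs m))

∸-telescope : ∀ e b m → e ≤ b → b ≤ m → (b ∸ e) + (m ∸ b) ≡ m ∸ e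
∸-telescope e b m e≤b b≤m = sym (begin
  m ∸ e             ≡⟨ cong (_∸ e) (sym (ℕP.m+[n∸m]≡n b≤m)) ⟩
  (b + (m ∸ b)) ∸ e ≡⟨ ℕP.+-∸-comm (m ∸ b) e≤b ⟩
  (b ∸ e) + (m ∸ b) ∎)
  where open ≡-Reasoning

countE-pathFrom : ∀ e bs m → Linked _≤_ (e ∷ bs) → All (_≤ m) bs → countE (pathFrom e bs m) ≡ m ∸ e
countE-pathFrom e [] m L A = countE-Es (m ∸ e)
countE-pathFrom e (b ∷ bs) m (e≤b ∷ L) (b≤m ∷ A) =
  trans (countE-Es++ (b ∸ e) _) (trans (cong ((b ∸ e) +_) (countE-pathFrom b bs m L A)) (∸-telescope e b m e≤b b≤m))

aboveDiag-Es++ : ∀ a k e w → e + k ≤ a → AboveDiag a (e + k) w → AboveDiag a e (replicate k E ++ w)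
aboveDiag-Es++ a zero e w le ad rewrite ℕP.+-identityʳ e = ad
aboveDiag-Es++ a (suc k) e w le ad =
  stepE (ℕP.≤-trans (s≤s (ℕP.m≤m+n e k)) (ℕP.≤-trans (ℕP.≤-reflexive (sym (ℕP.+-suc e k))) le))
        (aboveDiag-Es++ a k (suc e) w (subst (_≤ a) (ℕP.+-suc e k) le) (subst (λ z → AboveDiag a z w) (ℕP.+-suc e k) ad))

aboveDiag-pathFrom : ∀ a e bs m → Bounded a bs → Linked _≤_ (e ∷ bs) → e ≤ a → m ≤ a + length bs → AboveDiag a e (pathFrom e bs m)
aboveDiag-pathFrom a e [] m B L le mle = subst (AboveDiag a e) (List.++-identityʳ (replicate (m ∸ e) E)) (aboveDiag-Es++ a (m ∸ e) e [] bound done)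
  where
  m≤a : m ≤ a
  m≤a = subst (m ≤_) (ℕP.+-identityʳ a) mle
  bound : e + (m ∸ e) ≤ a
  bound with e ℕ.≤? m
  ... | yes e≤m = subst (_≤ a) (sym (ℕP.m+[n∸m]≡n e≤m)) m≤a
  ... | no e≰m = subst (_≤ a) (sym (trans (cong (e +_) (ℕP.m≤n⇒m∸n≡0 (ℕP.≰⇒≥ e≰m))) (ℕP.+-identityʳ e))) le
aboveDiag-pathFrom a e (b ∷ bs) m (b≤a , B) (e≤b ∷ L) le mle =
  aboveDiag-Es++ a (b ∸ e) e _ (subst (_≤ a) (sym (ℕP.m+[n∸m]≡n e≤b)) b≤a)
    (subst (λ z → AboveDiag a z (N ∷ pathFrom b bs m)) (sym (ℕP.m+[n∸m]≡n e≤b))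
      (stepN (aboveDiag-pathFrom (suc a) b bs m B L (ℕP.≤-trans b≤a (ℕP.n≤1+n a)) (subst (m ≤_) (ℕP.+-suc a (length bs)) mle))))

joinE-N∷ : ∀ r rs → joinE ((N ∷ r) ∷ rs) ≡ N ∷ joinE (r ∷ rs)
joinE-N∷ r [] = refl
joinE-N∷ r (x ∷ rs) = refl

runs-skip : ∀ k s e bs → e < s →
  map (λ j → replicate (indicator (e ≡ᵇ j) + count (λ b → b ≡ᵇ j) bs) N) (range s k) ≡ runs bs (range s k)
runs-skip zero s e bs lt = refl
runs-skip (suc k) s e bs lt rewrite ≡ᵇ-false e s (λ eq → ℕP.<-irrefl eq lt) =
  cong (_ ∷_) (runs-skip k (suc s) e bs (ℕP.≤-trans lt (ℕP.n≤1+n s)))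

count-≡ᵇ-absent : ∀ e bs → All (λ b → suc e ≤ b) bs → count (λ b → b ≡ᵇ e) bs ≡ 0
count-≡ᵇ-absent e [] A = refl
count-≡ᵇ-absent e (b ∷ bs) (h ∷ A) rewrite ≡ᵇ-false b e (λ eq → ℕP.<-irrefl (sym eq) h) = count-≡ᵇ-absent e bs A

mutual
  pathFrom≡runs : ∀ k e bs → Linked _≤_ bs → All (λ b → e ≤ b × b ≤ e + k) bs →
    pathFrom e bs (e + k) ≡ joinE (runs bs (range e (suc k)))
  pathFrom≡runs k e [] L A = pathFrom≡runs-< k e [] L []
  pathFrom≡runs k e (b ∷ bs) L ((e≤b , b≤) ∷ A) with ℕP.m≤n⇒m<n∨m≡n e≤b
  ... | inj₁ e<b = pathFrom≡runs-< k e (b ∷ bs) L (A' e<b)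
    where
    A' : e < b → All (λ b → suc e ≤ b × b ≤ e + k) (b ∷ bs)
    A' lt = (lt , b≤) ∷ All.zipWith (λ { (p , (_ , q)) → ℕP.≤-trans lt p , q })
                          (All.tail (Linked.Linked⇒All ℕP.≤-trans ℕP.≤-refl L) , A)
  ... | inj₂ refl rewrite ℕP.n∸n≡0 e | ≡ᵇ-refl e =
    trans (cong (N ∷_) (pathFrom≡runs k e bs (Linked.tail L) A))
      (trans (sym (joinE-N∷ (replicate (count (λ b → b ≡ᵇ e) bs) N) (runs bs (range (suc e) k))))
        (cong (λ z → joinE ((N ∷ replicate (count (λ b → b ≡ᵇ e) bs) N) ∷ z)) (sym (runs-skip k (suc e) e bs ℕP.≤-refl))))

  pathFrom≡runs-< : ∀ k e bs → Linked _≤_ bs → All (λ b → suc e ≤ b × b ≤ e + k) bs →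
    pathFrom e bs (e + k) ≡ joinE (runs bs (range e (suc k)))
  pathFrom≡runs-< zero e [] L A rewrite ℕP.+-identityʳ e | ℕP.n∸n≡0 e = refl
  pathFrom≡runs-< zero e (b ∷ bs) L ((h , h') ∷ A) = ⊥-elim (ℕP.<-irrefl refl (ℕP.≤-trans h (subst (b ≤_) (ℕP.+-identityʳ e) h')))
  pathFrom≡runs-< (suc k) e bs L A =
    trans (pathFrom-E∷ e bs (e + suc k) (All.map proj₁ A) (subst (suc e ≤_) (sym (ℕP.+-suc e k)) (s≤s (ℕP.m≤m+n e k))))
     (trans (cong (λ z → E ∷ pathFrom (suc e) bs z) (ℕP.+-suc e k))
      (trans (cong (E ∷_) (pathFrom≡runs k (suc e) bs L (All.map (λ { (p , q) → p , ℕP.≤-trans q (ℕP.≤-reflexive (ℕP.+-suc e k)) }) A)))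
        (cong (λ z → joinE (replicate z N ∷ runs bs (range (suc e) (suc k)))) (sym (count-≡ᵇ-absent e bs (All.map proj₁ A))))))


-- φ as the merge of S and S + 1

-- Kept abstract so that type checking never normalises rational comparisons.
abstract
  ltᵇ : ℚ → ℚ → Bool
  ltᵇ x y = does (x ℚ.<? y)

  ltᵇ-true : ∀ {x y} → x ℚ.< y → ltᵇ x y ≡ true
  ltᵇ-true {x} {y} p = dec-true (x ℚ.<? y) p

  ltᵇ-sound : ∀ {x y} → ltᵇ x y ≡ true → x ℚ.< y
  ltᵇ-sound {x} {y} p = does-sound (x ℚ.<? y) p

  ltᵇ-false : ∀ {x y} → ¬ (x ℚ.< y) → ltᵇ x y ≡ false
  ltᵇ-false {x} {y} p = dec-false (x ℚ.<? y) p

ltᵇ-false⁻ : ∀ {x y} → ltᵇ x y ≡ false → ¬ (x ℚ.< y)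
ltᵇ-false⁻ e p with trans (sym e) (ltᵇ-true p)
... | ()

downDegree : List ℚ → ℚ → ℕ
downDegree S x = count (λ y → ltᵇ (y ℚ.+ 1ℚ) x) S

downDegrees : List ℚ → List ℕ
downDegrees S = map (downDegree S) S

-- The step function of phiWord is local to its where-block; unification recovers it.
stepOf : List ℚ → ℚ → Step
stepOf S = stepFunction (refl {x = phiWord S})
  where
  stepFunction : ∀ {f : ℚ → Step} {L} → map f L ≡ map f L → ℚ → Step
  stepFunction {f} _ = f

stepOf-∈ : ∀ S y → y ∈ S → stepOf S y ≡ N
stepOf-∈ S y p with y ∈? S
... | yes _ = refl
... | no q = ⊥-elim (q p)

stepOf-∉ : ∀ S y → y ∉ S → stepOf S y ≡ E
stepOf-∉ S y p with y ∈? S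
... | yes q = ⊥-elim (p q)
... | no _ = refl

tagE : List ℚ → List (ℚ × Step)
tagE [] = []
tagE (y ∷ ys) = (y , E) ∷ tagE ys

tagN : List ℚ → List (ℚ × Step)
tagN [] = []
tagN (y ∷ ys) = (y , N) ∷ tagN ys

merge : List ℚ → List ℚ → List (ℚ × Step)
merge [] ys = tagE ys
merge (x ∷ xs) [] = tagN (x ∷ xs)
merge (x ∷ xs) (y ∷ ys) = if ltᵇ x y then (x , N) ∷ merge xs (y ∷ ys) else (y , E) ∷ merge (x ∷ xs) ys

keys-tagE : ∀ ys → map proj₁ (tagE ys) ≡ ys
keys-tagE [] = refl
keys-tagE (y ∷ ys) = cong (y ∷_) (keys-tagE ys)

keys-tagN : ∀ ys → map proj₁ (tagN ys) ≡ ys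
keys-tagN [] = refl
keys-tagN (y ∷ ys) = cong (y ∷_) (keys-tagN ys)

keys-merge-↭ : ∀ xs ys → map proj₁ (merge xs ys) ↭ xs ++ ys
keys-merge-↭ [] ys = ↭.↭-reflexive (keys-tagE ys)
keys-merge-↭ (x ∷ xs) [] = ↭.↭-reflexive (trans (keys-tagN (x ∷ xs)) (sym (List.++-identityʳ (x ∷ xs))))
keys-merge-↭ (x ∷ xs) (y ∷ ys) = mp (ltᵇ x y) (keys-merge-↭ xs (y ∷ ys)) (keys-merge-↭ (x ∷ xs) ys)
  where
  mp : ∀ b → map proj₁ (merge xs (y ∷ ys)) ↭ xs ++ y ∷ ys → map proj₁ (merge (x ∷ xs) ys) ↭ (x ∷ xs) ++ ys →
    map proj₁ (if b then (x , N) ∷ merge xs (y ∷ ys) else (y , E) ∷ merge (x ∷ xs) ys) ↭ (x ∷ xs) ++ (y ∷ ys)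
  mp true p q = prep x p
  mp false p q = ↭-trans (prep y q) (↭-sym (↭.shift y (x ∷ xs) ys))

keys-merge-sorted-from : ∀ z xs ys → Linked ℚ._≤_ (z ∷ xs) → Linked ℚ._≤_ (z ∷ ys) → Linked ℚ._≤_ (z ∷ map proj₁ (merge xs ys))
keys-merge-sorted-from z [] ys Lx Ly rewrite keys-tagE ys = Ly
keys-merge-sorted-from z (x ∷ xs) [] Lx Ly rewrite keys-tagN xs = Lx
keys-merge-sorted-from z (x ∷ xs) (y ∷ ys) (zx ∷ Lx) (zy ∷ Ly) =
  ms (ltᵇ x y) refl (λ h → keys-merge-sorted-from x xs (y ∷ ys) Lx (h ∷ Ly)) (λ h → keys-merge-sorted-from y (x ∷ xs) ys (h ∷ Lx) Ly)
  where
  ms : ∀ b → ltᵇ x y ≡ b → (x ℚ.≤ y → Linked ℚ._≤_ (x ∷ map proj₁ (merge xs (y ∷ ys)))) →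
    (y ℚ.≤ x → Linked ℚ._≤_ (y ∷ map proj₁ (merge (x ∷ xs) ys))) →
    Linked ℚ._≤_ (z ∷ map proj₁ (if b then (x , N) ∷ merge xs (y ∷ ys) else (y , E) ∷ merge (x ∷ xs) ys))
  ms true eq f g = zx ∷ f (ℚP.<⇒≤ (ltᵇ-sound eq))
  ms false eq f g = zy ∷ g (ℚP.≮⇒≥ (ltᵇ-false⁻ eq))

keys-merge-sorted : ∀ xs ys → Linked ℚ._≤_ xs → Linked ℚ._≤_ ys → Linked ℚ._≤_ (map proj₁ (merge xs ys))
keys-merge-sorted [] ys Lx Ly rewrite keys-tagE ys = Ly
keys-merge-sorted (x ∷ xs) [] Lx Ly rewrite keys-tagN xs = Lx
keys-merge-sorted (x ∷ xs) (y ∷ ys) Lx Ly = ms (ltᵇ x y) refl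
  where
  ms : ∀ b → ltᵇ x y ≡ b →
    Linked ℚ._≤_ (map proj₁ (if b then (x , N) ∷ merge xs (y ∷ ys) else (y , E) ∷ merge (x ∷ xs) ys))
  ms true eq = keys-merge-sorted-from x xs (y ∷ ys) Lx (ℚP.<⇒≤ (ltᵇ-sound eq) ∷ Ly)
  ms false eq = keys-merge-sorted-from y (x ∷ xs) ys (ℚP.≮⇒≥ (ltᵇ-false⁻ eq) ∷ Lx) Ly

sort-sorted-↭ : ∀ X L → Linked ℚ._≤_ L → L ↭ X → sort X ≡ L
sort-sorted-↭ X L sL p = Pointwise.Pointwise-≡⇒≡ (Sorted.↗↭↗⇒≋ (DecTotalOrder.totalOrder ℚP.≤-decTotalOrder) (sort-↗ X) sL
  (↭ₕ.map id (↭.↭⇒↭ₛ (↭-trans (sort-↭ X) (↭-sym p)))))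

merge-tagged : ∀ S xs ys → All (_∈ S) xs → All (_∉ S) ys → All (λ p → stepOf S (proj₁ p) ≡ proj₂ p) (merge xs ys)
merge-tagged S [] ys Ax Ay = tE ys Ay
  where
  tE : ∀ ys → All (_∉ S) ys → All (λ p → stepOf S (proj₁ p) ≡ proj₂ p) (tagE ys)
  tE [] _ = []
  tE (y ∷ ys) (py ∷ Ay) = stepOf-∉ S y py ∷ tE ys Ay
merge-tagged S (x ∷ xs) [] Ax Ay = tN (x ∷ xs) Ax
  where
  tN : ∀ xs → All (_∈ S) xs → All (λ p → stepOf S (proj₁ p) ≡ proj₂ p) (tagN xs)
  tN [] _ = []
  tN (x ∷ xs) (px ∷ Ax) = stepOf-∈ S x px ∷ tN xs Ax
merge-tagged S (x ∷ xs) (y ∷ ys) (px ∷ Ax) (py ∷ Ay) = h (ltᵇ x y) (merge-tagged S xs (y ∷ ys) Ax (py ∷ Ay)) (merge-tagged S (x ∷ xs) ys (px ∷ Ax) Ay)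
  where
  P : ℚ × Step → Set
  P = λ (p : ℚ × Step) → stepOf S (proj₁ p) ≡ proj₂ p
  h : ∀ b → All P (merge xs (y ∷ ys)) → All P (merge (x ∷ xs) ys) → All P (if b then (x , N) ∷ merge xs (y ∷ ys) else (y , E) ∷ merge (x ∷ xs) ys)
  h true r1 r2 = stepOf-∈ S x px ∷ r1
  h false r1 r2 = stepOf-∉ S y py ∷ r2

map-stepOf-merge : ∀ S xs ys → All (_∈ S) xs → All (_∉ S) ys → map (stepOf S) (map proj₁ (merge xs ys)) ≡ map proj₂ (merge xs ys)
map-stepOf-merge S xs ys Ax Ay = trans (sym (List.map-∘ (merge xs ys))) (List.map-cong-local (merge-tagged S xs ys Ax Ay))

tags-tagE : ∀ ys → map proj₂ (tagE ys) ≡ replicate (length ys) E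
tags-tagE [] = refl
tags-tagE (y ∷ ys) = cong (E ∷_) (tags-tagE ys)

tags-tagN : ∀ xs → map proj₂ (tagN xs) ≡ pathFrom 0 (map (λ _ → 0) xs) 0
tags-tagN [] = refl
tags-tagN (x ∷ xs) = cong (N ∷_) (tags-tagN xs)

pathFrom-suc : ∀ e bs m → pathFrom (suc e) (map suc bs) (suc m) ≡ pathFrom e bs m
pathFrom-suc e [] m = refl
pathFrom-suc e (b ∷ bs) m = cong (λ z → replicate (b ∸ e) E ++ N ∷ z) (pathFrom-suc b bs m)

pathFrom-0-suc : ∀ bs m → pathFrom 0 (map suc bs) (suc m) ≡ E ∷ pathFrom 0 bs m
pathFrom-0-suc [] m = refl
pathFrom-0-suc (b ∷ bs) m = cong (λ z → E ∷ replicate b E ++ N ∷ z) (pathFrom-suc b bs m)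

tags-merge : ∀ xs ys → Linked ℚ._<_ xs → Linked ℚ._<_ ys → (∀ x y → x ∈ xs → y ∈ ys → x ≢ y) →
  map proj₂ (merge xs ys) ≡ pathFrom 0 (map (λ x → count (λ y → ltᵇ y x) ys) xs) (length ys)
tags-merge [] ys Lx Ly D = tags-tagE ys
tags-merge (x ∷ xs) [] Lx Ly D = tags-tagN (x ∷ xs)
tags-merge (x ∷ xs) (y ∷ ys) Lx Ly D =
  h (ltᵇ x y) refl (tags-merge xs (y ∷ ys) (Linked.tail Lx) Ly (λ a b a∈ b∈ → D a b (there a∈) b∈))
    (tags-merge (x ∷ xs) ys Lx (Linked.tail Ly) (λ a b a∈ b∈ → D a b a∈ (there b∈)))
  where
  h : ∀ b → ltᵇ x y ≡ b →
    map proj₂ (merge xs (y ∷ ys)) ≡ pathFrom 0 (map (λ x → count (λ y → ltᵇ y x) (y ∷ ys)) xs) (length (y ∷ ys)) →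
    map proj₂ (merge (x ∷ xs) ys) ≡ pathFrom 0 (map (λ x → count (λ y → ltᵇ y x) ys) (x ∷ xs)) (length ys) →
    map proj₂ (if b then (x , N) ∷ merge xs (y ∷ ys) else (y , E) ∷ merge (x ∷ xs) ys)
      ≡ pathFrom 0 (map (λ x → count (λ y → ltᵇ y x) (y ∷ ys)) (x ∷ xs)) (length (y ∷ ys))
  h true eq p q =
    trans (cong (N ∷_) p) (cong (λ z → pathFrom 0 (z ∷ map (λ x → count (λ y → ltᵇ y x) (y ∷ ys)) xs) (suc (length ys))) (sym c0))
    where
    x<y : x ℚ.< y
    x<y = ltᵇ-sound eq
    Ay : All (x ℚ.<_) (y ∷ ys)
    Ay = Linked.Linked⇒All ℚP.<-trans x<y Ly
    c0 : count (λ y → ltᵇ y x) (y ∷ ys) ≡ 0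
    c0 = count-none _ (y ∷ ys) (λ z z∈ → ltᵇ-false (ℚP.<-asym (All.lookup Ay z∈)))
  h false eq p q = trans (cong (E ∷_) q)
    (trans (sym (pathFrom-0-suc (map (λ x → count (λ y → ltᵇ y x) ys) (x ∷ xs)) (length ys)))
      (cong (λ z → pathFrom 0 z (suc (length ys)))
        (trans (sym (List.map-∘ {g = suc} {f = λ x → count (λ y → ltᵇ y x) ys} (x ∷ xs))) (List.map-cong-local (All.map step Ax)))))
    where
    y<x : y ℚ.< x
    y<x with ℚP.<-cmp x y
    ... | tri< a _ _ = ⊥-elim (ltᵇ-false⁻ eq a)
    ... | tri≈ _ b _ = ⊥-elim (D x y (here refl) (here refl) b)
    ... | tri> _ _ c = c
    Ax : All (y ℚ.<_) (x ∷ xs)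
    Ax = Linked.Linked⇒All ℚP.<-trans y<x Lx
    step : ∀ {z} → y ℚ.< z → suc (count (λ y → ltᵇ y z) ys) ≡ count (λ y → ltᵇ y z) (y ∷ ys)
    step lt rewrite ltᵇ-true lt = refl

plusOne : List ℚ → List ℚ
plusOne S = map (ℚ._+ 1ℚ) S

phiWord≡pathFrom : ∀ S → Good S → phiWord S ≡ pathFrom 0 (downDegrees S) (length S)
phiWord≡pathFrom S (inc , gd) = begin
  phiWord S                                          ≡⟨⟩
  map (stepOf S) (sort (S ++ plusOne S))             ≡⟨ cong (map (stepOf S)) sort-merge ⟩
  map (stepOf S) (map proj₁ (merge S (plusOne S)))   ≡⟨ map-stepOf-merge S S (plusOne S) (All.tabulate id) notin ⟩
  map proj₂ (merge S (plusOne S))                    ≡⟨ tags-merge S (plusOne S) inc incP disj ⟩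
  pathFrom 0 (map (λ x → count (λ y → ltᵇ y x) (plusOne S)) S) (length (plusOne S))
    ≡⟨ cong₂ (pathFrom 0) (List.map-cong (λ x → count-map (λ y → ltᵇ y x) (ℚ._+ 1ℚ) S) S) (List.length-map (ℚ._+ 1ℚ) S) ⟩
  pathFrom 0 (downDegrees S) (length S)              ∎
  where
  open ≡-Reasoning
  incP : Linked ℚ._<_ (plusOne S)
  incP = Linked.map⁺ (Linked.map (ℚP.+-monoˡ-< 1ℚ) inc)
  notin : All (_∉ S) (plusOne S)
  notin = All.tabulate λ {y} y∈ → case ∈.∈-map⁻ (ℚ._+ 1ℚ) y∈ of λ { (s , s∈ , refl) → gd s s∈ }
  disj : ∀ x y → x ∈ S → y ∈ plusOne S → x ≢ y
  disj x y x∈ y∈ refl = All.lookup notin y∈ x∈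
  sort-merge : sort (S ++ plusOne S) ≡ map proj₁ (merge S (plusOne S))
  sort-merge = sort-sorted-↭ (S ++ plusOne S) _
    (keys-merge-sorted S (plusOne S) (Linked.map ℚP.<⇒≤ inc) (Linked.map ℚP.<⇒≤ incP)) (keys-merge-↭ S (plusOne S))


-- Down-degrees

belowᵇ : (S : List ℚ) → Fin (length S) → Fin (length S) → Bool
belowᵇ S i j = ltᵇ (lookup S i ℚ.+ 1ℚ) (lookup S j)

downDegreeAt : (S : List ℚ) → Fin (length S) → ℕ
downDegreeAt S j = countFin (length S) (λ i → belowᵇ S i j)

degreeCount : List ℚ → ℕ → ℕ
degreeCount S k = countFin (length S) (λ j → downDegreeAt S j ≡ᵇ k)

degreeWord : List ℚ → List Step
degreeWord S = joinE (map (λ k → replicate (degreeCount S k) N) (range 0 (suc (length S))))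

downDegreeAt-lookup : ∀ S j → downDegreeAt S j ≡ downDegree S (lookup S j)
downDegreeAt-lookup S j = countFin-lookup (λ y → ltᵇ (y ℚ.+ 1ℚ) (lookup S j)) S

degreeCount-downDegrees : ∀ S k → degreeCount S k ≡ count (λ b → b ≡ᵇ k) (downDegrees S)
degreeCount-downDegrees S k = trans (countFin-cong (length S) (λ j → cong (_≡ᵇ k) (downDegreeAt-lookup S j)))
  (trans (countFin-lookup (λ x → downDegree S x ≡ᵇ k) S) (sym (count-map (λ b → b ≡ᵇ k) (downDegree S) S)))

x<x+1 : ∀ x → x ℚ.< x ℚ.+ 1ℚ
x<x+1 x = subst (ℚ._< x ℚ.+ 1ℚ) (ℚP.+-identityʳ x) (ℚP.+-monoʳ-< x (ℚP.positive⁻¹ 1ℚ))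

downDegrees-sorted : ∀ S → Linked ℚ._<_ S → Linked _≤_ (downDegrees S)
downDegrees-sorted S inc = Linked.map⁺ (Linked.map (λ {x} {y} x<y → count-mono S (λ z e → ltᵇ-true (ℚP.<-trans (ltᵇ-sound e) x<y))) inc)

bounded-step : ∀ {A : Set} k (f g : A → ℕ) (L : List A) → Bounded k (map f L) → (∀ z → g z ≤ suc (f z)) → Bounded (suc k) (map g L)
bounded-step k f g [] B h = tt
bounded-step k f g (z ∷ L) (b , B) h = ℕP.≤-trans (h z) (s≤s b) , bounded-step (suc k) f g L B h

indicator≤1 : ∀ b → indicator b ≤ 1
indicator≤1 true = s≤s z≤n
indicator≤1 false = z≤n

downDegrees-bounded : ∀ S → Linked ℚ._<_ S → Bounded 0 (downDegrees S)
downDegrees-bounded [] inc = tt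
downDegrees-bounded (x ∷ S) inc = ℕP.≤-reflexive head0 ,
  bounded-step 0 (downDegree S) (downDegree (x ∷ S)) S (downDegrees-bounded S (Linked.tail inc))
    (λ z → ℕP.+-monoˡ-≤ (downDegree S z) (indicator≤1 (ltᵇ (x ℚ.+ 1ℚ) z)))
  where
  Ax : All (x ℚ.<_) S
  Ax = AllPairs.head (Linked.Linked⇒AllPairs ℚP.<-trans inc)
  head0 : downDegree (x ∷ S) x ≡ 0
  head0 = count-none _ (x ∷ S) λ { y (here refl) → ltᵇ-false (ℚP.<-asym (x<x+1 y))
                              ; y (there y∈) → ltᵇ-false (λ lt → ℚP.<-asym (ℚP.<-trans (All.lookup Ax y∈) (x<x+1 y)) lt) }

bounded⇒< : ∀ k bs → Bounded k bs → All (λ b → b < k + length bs) bs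
bounded⇒< k [] B = []
bounded⇒< k (b ∷ bs) (h , B) = ℕP.≤-trans (s≤s (ℕP.≤-trans h (ℕP.m≤m+n k (length bs)))) (ℕP.≤-reflexive (sym (ℕP.+-suc k (length bs)))) ∷
  All.map (λ lt → ℕP.≤-trans lt (ℕP.≤-reflexive (sym (ℕP.+-suc k (length bs))))) (bounded⇒< (suc k) bs B)

linked-0∷ : ∀ bs → Linked _≤_ bs → Linked _≤_ (0 ∷ bs)
linked-0∷ [] L = [-]
linked-0∷ (b ∷ bs) L = z≤n ∷ L

phiWord≡degreeWord : ∀ S → Good S → phiWord S ≡ degreeWord S
phiWord≡degreeWord S g@(inc , _) = trans (phiWord≡pathFrom S g) (trans
  (subst (λ m → pathFrom 0 (downDegrees S) m ≡ joinE (runs (downDegrees S) (range 0 (suc m)))) (List.length-map (downDegree S) S)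
    (pathFrom≡runs (length (downDegrees S)) 0 (downDegrees S) (downDegrees-sorted S inc)
      (All.map (λ lt → z≤n , ℕP.<⇒≤ lt) (bounded⇒< 0 (downDegrees S) (downDegrees-bounded S inc)))))
  (cong joinE (List.map-cong (λ k → cong (λ z → replicate z N) (sym (degreeCount-downDegrees S k))) (range 0 (suc (length S))))))

phiWord-isDyck : ∀ n S → Good S → length S ≡ n → IsDyck n (phiWord S)
phiWord-isDyck n S g@(inc , _) refl rewrite phiWord≡pathFrom S g =
  trans (countN-pathFrom 0 ds (length S)) length-ds ,
  countE-pathFrom 0 ds (length S) sorted (All.map (λ lt → ℕP.≤-trans (ℕP.<⇒≤ lt) (ℕP.≤-reflexive length-ds)) (bounded⇒< 0 ds bounded)) ,
  aboveDiag-pathFrom 0 0 ds (length S) bounded sorted z≤n (ℕP.≤-reflexive (sym length-ds))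
  where
  ds : List ℕ
  ds = downDegrees S
  length-ds : length ds ≡ length S
  length-ds = List.length-map (downDegree S) S
  sorted : Linked _≤_ (0 ∷ ds)
  sorted = linked-0∷ _ (downDegrees-sorted S inc)
  bounded : Bounded 0 ds
  bounded = downDegrees-bounded S inc

belowᵇ-sound : ∀ S i j → belowᵇ S i j ≡ true → Leq S i j × i ≢ j
belowᵇ-sound S i j e = inj₂ (ltᵇ-sound e) , λ { refl → ℚP.<-asym (x<x+1 (lookup S i)) (ltᵇ-sound e) }

belowᵇ-complete : ∀ S i j → Leq S i j → i ≢ j → belowᵇ S i j ≡ true
belowᵇ-complete S i j (inj₁ eq) ne = ⊥-elim (ne eq)
belowᵇ-complete S i j (inj₂ lt) ne = ltᵇ-true lt

module IsoInvariance (S S' : List ℚ) (iso : PosetIso S S') where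
  private
    e : Fin (length S) ↔ Fin (length S')
    e = proj₁ iso
    to : Fin (length S) → Fin (length S')
    to = Inverse.to e
    preserves : ∀ i j → Leq S i j ⇔ Leq S' (to i) (to j)
    preserves = proj₂ iso

  to-injective : ∀ {i j} → to i ≡ to j → i ≡ j
  to-injective {i} {j} eq = trans (sym (Inverse.strictlyInverseʳ e i)) (trans (cong (Inverse.from e) eq) (Inverse.strictlyInverseʳ e j))

  belowᵇ-preserved : ∀ i j → belowᵇ S i j ≡ belowᵇ S' (to i) (to j)
  belowᵇ-preserved i j = bool-ext
    (λ t → let (l , ne) = belowᵇ-sound S i j t in belowᵇ-complete S' (to i) (to j) (Equivalence.to (preserves i j) l) (λ eq → ne (to-injective eq)))
    (λ t → let (l , ne) = belowᵇ-sound S' (to i) (to j) t in belowᵇ-complete S i j (Equivalence.from (preserves i j) l) (λ eq → ne (cong to eq)))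

  downDegreeAt-preserved : ∀ j → downDegreeAt S j ≡ downDegreeAt S' (to j)
  downDegreeAt-preserved j = trans (countFin-cong (length S) (λ i → belowᵇ-preserved i j)) (countFin-permute e (λ i' → belowᵇ S' i' (to j)))

  degreeCount-preserved : ∀ k → degreeCount S k ≡ degreeCount S' k
  degreeCount-preserved k = trans (countFin-cong (length S) (λ j → cong (_≡ᵇ k) (downDegreeAt-preserved j)))
    (countFin-permute e (λ j' → downDegreeAt S' j' ≡ᵇ k))

  degreeWord-preserved : degreeWord S ≡ degreeWord S'
  degreeWord-preserved = trans (cong joinE (List.map-cong (λ k → cong (λ z → replicate z N) (degreeCount-preserved k)) (range 0 (suc (length S)))))
                  (cong (λ m → joinE (map (λ k → replicate (degreeCount S' k) N) (range 0 (suc m)))) (↔⇒≡ e))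

phiWord-isoInvariant : ∀ S S' → Good S → Good S' → PosetIso S S' → phiWord S ≡ phiWord S'
phiWord-isoInvariant S S' g g' iso = trans (phiWord≡degreeWord S g) (trans (IsoInvariance.degreeWord-preserved S S' iso) (sym (phiWord≡degreeWord S' g')))

-- Since S is increasing, the elements below x_j form an initial segment of S.
below⇔<downDegree : ∀ S → Good S → ∀ i j → (lookup S i ℚ.+ 1ℚ ℚ.< lookup S j) ⇔ (toℕ i < downDegreeAt S j)
below⇔<downDegree S (inc , _) i j = mk⇔ (λ lt → Equivalence.to (D i) (ltᵇ-true lt)) (λ lt → ltᵇ-sound (Equivalence.from (D i) lt))
  where
  srt : Linked ℚ._≤_ S
  srt = Linked.map ℚP.<⇒≤ inc
  dc : ∀ a b → toℕ a ≤ toℕ b → belowᵇ S b j ≡ true → belowᵇ S a j ≡ true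
  dc a b le t = ltᵇ-true (ℚP.≤-<-trans (ℚP.+-monoˡ-≤ 1ℚ (Sorted.lookup-mono-≤ (DecTotalOrder.totalOrder ℚP.≤-decTotalOrder) srt le)) (ltᵇ-sound t))
  D : ∀ a → (belowᵇ S a j ≡ true) ⇔ (toℕ a < downDegreeAt S j)
  D = countFin-downClosed (length S) (λ a → belowᵇ S a j) dc

map-lookup-≡ : ∀ (f g : ℚ → ℕ) S S' → map f S ≡ map g S' → (eq : length S ≡ length S') →
  ∀ j → f (lookup S j) ≡ g (lookup S' (cast eq j))
map-lookup-≡ f g (x ∷ S) (x' ∷ S') me eq zero = List.∷-injectiveˡ me
map-lookup-≡ f g (x ∷ S) (x' ∷ S') me eq (suc j) = map-lookup-≡ f g S S' (List.∷-injectiveʳ me) (cong pred eq) j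

northColumns-phiWord : ∀ S → Good S → northColumns 0 (phiWord S) ≡ downDegrees S
northColumns-phiWord S g@(inc , _) = trans (cong (northColumns 0) (phiWord≡pathFrom S g))
  (northColumns-pathFrom 0 (downDegrees S) (length S) (linked-0∷ _ (downDegrees-sorted S inc)))

-- The down-degrees are read off the path and determine the order, so the identity is an isomorphism.
phiWord-injective : ∀ S S' → Good S → Good S' → length S ≡ length S' → phiWord S ≡ phiWord S' → PosetIso S S'
phiWord-injective S S' g g' eq pe = cast-id eq , λ i j → mk⇔ (fw i j) (bw i j)
  where
  beq : downDegrees S ≡ downDegrees S'
  beq = trans (sym (northColumns-phiWord S g)) (trans (cong (northColumns 0) pe) (northColumns-phiWord S' g'))
  dn-eq : ∀ j → downDegreeAt S j ≡ downDegreeAt S' (cast eq j)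
  dn-eq j = trans (downDegreeAt-lookup S j) (trans (map-lookup-≡ (downDegree S) (downDegree S') S S' beq eq j) (sym (downDegreeAt-lookup S' (cast eq j))))
  fw : ∀ i j → Leq S i j → Leq S' (cast eq i) (cast eq j)
  fw i j (inj₁ refl) = inj₁ refl
  fw i j (inj₂ lt) = inj₂ (Equivalence.from (below⇔<downDegree S' g' (cast eq i) (cast eq j))
    (subst₂ _<_ (sym (Fin.toℕ-cast eq i)) (dn-eq j) (Equivalence.to (below⇔<downDegree S g i j) lt)))
  bw : ∀ i j → Leq S' (cast eq i) (cast eq j) → Leq S i j
  bw i j (inj₁ e) = inj₁ (Fin.toℕ-injective (trans (sym (Fin.toℕ-cast eq i)) (trans (cong toℕ e) (Fin.toℕ-cast eq j))))
  bw i j (inj₂ lt) = inj₂ (Equivalence.from (below⇔<downDegree S g i j)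
    (subst₂ _<_ (Fin.toℕ-cast eq i) (sym (dn-eq j)) (Equivalence.to (below⇔<downDegree S' g' (cast eq i) (cast eq j)) lt)))


-- Realising a sequence of down-degrees

<ᵇ-true : ∀ {a b} → a < b → (a <ᵇ b) ≡ true
<ᵇ-true lt = Equivalence.to T-≡ (ℕP.<⇒<ᵇ lt)

<ᵇ-sound : ∀ {a b} → (a <ᵇ b) ≡ true → a < b
<ᵇ-sound {a} {b} e = ℕP.<ᵇ⇒< a b (Equivalence.from T-≡ e)

<ᵇ-false : ∀ {a b} → ¬ (a < b) → (a <ᵇ b) ≡ false
<ᵇ-false {a} {b} ¬lt with a <ᵇ b in e
... | true = ⊥-elim (¬lt (<ᵇ-sound e))
... | false = refl

double-< : ∀ {a b} → a < b → 2 * a < 2 * b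
double-< lt = ℕP.*-monoʳ-< 2 lt

double-<⁻ : ∀ {a b} → 2 * a < 2 * b → a < b
double-<⁻ {a} {b} lt = ℕP.*-cancelˡ-< 2 a b lt

double-≤ : ∀ {a b} → a ≤ b → 2 * a ≤ 2 * b
double-≤ le = ℕP.*-monoʳ-≤ 2 le

double-≤⁻ : ∀ {a b} → 2 * a ≤ 2 * b → a ≤ b
double-≤⁻ le = ℕP.*-cancelˡ-≤ 2 le

odd<even : ∀ a b → a ≤ b → 2 * a + 1 < 2 * b + 2
odd<even a b le = ℕP.≤-trans (ℕP.≤-reflexive (e a)) (ℕP.+-monoˡ-≤ 2 (double-≤ le))
  where
  e : ∀ a → suc (2 * a + 1) ≡ 2 * a + 2
  e = solve-∀

odd<even⁻ : ∀ a b → 2 * a + 1 < 2 * b + 2 → a ≤ b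
odd<even⁻ a b lt = double-≤⁻ (ℕP.+-cancelʳ-≤ 2 (2 * a) (2 * b) (ℕP.≤-trans (ℕP.≤-reflexive (sym (e a))) lt))
  where
  e : ∀ a → suc (2 * a + 1) ≡ 2 * a + 2
  e = solve-∀

odd≢even : ∀ a b → 2 * a + 1 ≢ 2 * b
odd≢even a b eq with ℕP.<-cmp a b
... | tri< a<b _ _ = ℕP.<-irrefl eq (ℕP.≤-trans (ℕP.≤-reflexive (e₁ a)) (double-≤ a<b))
  where
  e₁ : ∀ a → suc (2 * a + 1) ≡ 2 * suc a
  e₁ = solve-∀
... | tri≈ _ refl _ = ℕP.<-irrefl (sym eq) (ℕP.≤-reflexive (e₂ a))
  where
  e₂ : ∀ a → suc (2 * a) ≡ 2 * a + 1
  e₂ = solve-∀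
... | tri> _ _ b<a = ℕP.<-irrefl (sym eq) (ℕP.≤-trans (s≤s (double-≤ (ℕP.<⇒≤ b<a))) (ℕP.≤-reflexive (e₂ a)))
  where
  e₂ : ∀ a → suc (2 * a) ≡ 2 * a + 1
  e₂ = solve-∀

-- Points are now naturals with unit M: y is below x iff y + M < x.
downDegreeℕ : ℕ → List ℕ → ℕ → ℕ
downDegreeℕ M Xs X = count (λ Y → Y + M <ᵇ X) Xs

-- Doubling the unit and the points leaves the odd numbers free for a new point.
lift : ℕ → ℕ → ℕ
lift M x = 2 * x + 2 * M + 2

lift-< : ∀ M y x → (lift M y + 2 * M < lift M x) ⇔ (y + M < x)
lift-< M y x = mk⇔
  (λ lt → double-<⁻ (ℕP.+-cancelʳ-< (2 * M + 2) (2 * (y + M)) (2 * x) (subst₂ _<_ (e₁ M y) (e₂ M x) lt)))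
  (λ lt → subst₂ _<_ (sym (e₁ M y)) (sym (e₂ M x)) (ℕP.+-monoˡ-< (2 * M + 2) (double-< lt)))
  where
  e₁ : ∀ M y → 2 * y + 2 * M + 2 + 2 * M ≡ 2 * (y + M) + (2 * M + 2)
  e₁ = solve-∀
  e₂ : ∀ M x → 2 * x + 2 * M + 2 ≡ 2 * x + (2 * M + 2)
  e₂ = solve-∀

fresh-<-lift : ∀ M m x → (2 * m + 1 + 2 * M < lift M x) ⇔ (m ≤ x)
fresh-<-lift M m x = mk⇔
  (λ lt → odd<even⁻ m x (ℕP.+-cancelʳ-< (2 * M) (2 * m + 1) (2 * x + 2) (subst ((2 * m + 1 + 2 * M) <_) (e M x) lt)))
  (λ le → subst ((2 * m + 1 + 2 * M) <_) (sym (e M x)) (ℕP.+-monoˡ-< (2 * M) (odd<even m x le)))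
  where
  e : ∀ M x → 2 * x + 2 * M + 2 ≡ 2 * x + 2 + 2 * M
  e = solve-∀

fresh<lift : ∀ M m y → m ≤ y + M → 2 * m + 1 < lift M y
fresh<lift M m y le = subst ((2 * m + 1) <_) (sym (e M y)) (odd<even m (y + M) le)
  where
  e : ∀ M y → 2 * y + 2 * M + 2 ≡ 2 * (y + M) + 2
  e = solve-∀

fresh+≢lift : ∀ M m y → 2 * m + 1 + 2 * M ≢ lift M y
fresh+≢lift M m y eq = odd≢even (m + M) (y + M + 1) (trans (sym (e₁ M m)) (trans eq (e₂ M y)))
  where
  e₁ : ∀ M m → 2 * m + 1 + 2 * M ≡ 2 * (m + M) + 1
  e₁ = solve-∀
  e₂ : ∀ M y → 2 * y + 2 * M + 2 ≡ 2 * (y + M + 1)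
  e₂ = solve-∀

lift+≢lift : ∀ M y z → y + M ≢ z → lift M y + 2 * M ≢ lift M z
lift+≢lift M y z ne eq = ne (ℕP.*-cancelˡ-≡ (y + M) z 2 (ℕP.+-cancelʳ-≡ (2 * M + 2) (2 * (y + M)) (2 * z) (trans (sym (e₁ M y)) (trans eq (e₂ M z)))))
  where
  e₁ : ∀ M y → 2 * y + 2 * M + 2 + 2 * M ≡ 2 * (y + M) + (2 * M + 2)
  e₁ = solve-∀
  e₂ : ∀ M x → 2 * x + 2 * M + 2 ≡ 2 * x + (2 * M + 2)
  e₂ = solve-∀

lift-mono : ∀ M {x y} → x < y → lift M x < lift M y
lift-mono M {x} {y} lt = ℕP.+-monoˡ-< 2 (ℕP.+-monoˡ-< (2 * M) (double-< lt))

-- One more than the largest point whose prescribed down-degree is 0.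
minimalsBound : List ℕ → List ℕ → ℕ
minimalsBound (b ∷ bs) (x ∷ xs) = (if b ≡ᵇ 0 then suc x else 0) ⊔ minimalsBound bs xs
minimalsBound _ _ = 0

-- The new leftmost point 2m+1 lies below exactly the lifted points of positive prescribed degree.
extend : List ℕ → ℕ × List ℕ → ℕ × List ℕ
extend bs (M , Xs) = (2 * M , (2 * minimalsBound bs Xs + 1) ∷ map (lift M) Xs)

-- The first argument is fuel; length bs suffices.
realise : ℕ → List ℕ → ℕ × List ℕ
realise _ [] = 1 , []
realise zero (b ∷ bs) = 1 , []
realise (suc f) (b ∷ bs) = extend bs (realise f (map pred bs))

record Realises (bs : List ℕ) (M : ℕ) (Xs : List ℕ) : Set where
  field
    unit-pos : 1 ≤ M
    length≡ : length Xs ≡ length bs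
    increasing : Linked _<_ Xs
    shift-disjoint : ∀ x y → x ∈ Xs → y ∈ Xs → x + M ≢ y
    degrees : map (downDegreeℕ M Xs) Xs ≡ bs

∈-zip⇒∈₂ : ∀ {bs xs : List ℕ} {b x} → (b , x) ∈ zip bs xs → x ∈ xs
∈-zip⇒∈₂ {b' ∷ bs} {x' ∷ xs} (here refl) = here refl
∈-zip⇒∈₂ {b' ∷ bs} {x' ∷ xs} (there p) = there (∈-zip⇒∈₂ p)

map-≡⇒pointwise : ∀ (f g : ℕ → ℕ) (xs bs : List ℕ) → map f xs ≡ map g bs → ∀ b x → (b , x) ∈ zip bs xs → f x ≡ g b
map-≡⇒pointwise f g (x' ∷ xs) (b' ∷ bs) eq b x (here refl) = List.∷-injectiveˡ eq
map-≡⇒pointwise f g (x' ∷ xs) (b' ∷ bs) eq b x (there p) = map-≡⇒pointwise f g xs bs (List.∷-injectiveʳ eq) b x p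

pointwise⇒map-≡ : ∀ (f : ℕ → ℕ) (xs bs : List ℕ) → length xs ≡ length bs → (∀ b x → (b , x) ∈ zip bs xs → f x ≡ b) → map f xs ≡ bs
pointwise⇒map-≡ f [] [] _ h = refl
pointwise⇒map-≡ f (x ∷ xs) (b ∷ bs) eq h = cong₂ _∷_ (h b x (here refl)) (pointwise⇒map-≡ f xs bs (cong pred eq) (λ b' x' p → h b' x' (there p)))

ZipOrdered : ℕ × ℕ → ℕ × ℕ → Set
ZipOrdered p q = proj₁ p ≤ proj₁ q × proj₂ p < proj₂ q

zip-linked : ∀ bs xs → Linked _≤_ bs → Linked _<_ xs → Linked ZipOrdered (zip bs xs)
zip-linked [] xs _ _ = []
zip-linked (b ∷ []) [] _ _ = []
zip-linked (b ∷ []) (x ∷ xs) _ _ = [-]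
zip-linked (b ∷ b' ∷ bs) [] _ _ = []
zip-linked (b ∷ b' ∷ bs) (x ∷ []) _ _ = [-]
zip-linked (b ∷ b' ∷ bs) (x ∷ x' ∷ xs) (h ∷ L) (h' ∷ L') = (h , h') ∷ zip-linked (b' ∷ bs) (x' ∷ xs) L L'

ZipOrdered-trans : ∀ {p q r} → ZipOrdered p q → ZipOrdered q r → ZipOrdered p r
ZipOrdered-trans (a , b) (c , d) = ℕP.≤-trans a c , ℕP.<-trans b d

allPairs-trichotomy : ∀ {A : Set} {R : A → A → Set} {L : List A} {p q} → AllPairs R L → p ∈ L → q ∈ L → p ≡ q ⊎ R p q ⊎ R q p
allPairs-trichotomy (h ∷ ap) (here refl) (here refl) = inj₁ refl
allPairs-trichotomy (h ∷ ap) (here refl) (there q∈) = inj₂ (inj₁ (All.lookup h q∈))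
allPairs-trichotomy (h ∷ ap) (there p∈) (here refl) = inj₂ (inj₂ (All.lookup h p∈))
allPairs-trichotomy (h ∷ ap) (there p∈) (there q∈) = allPairs-trichotomy ap p∈ q∈

minimalsBound-≥ : ∀ bs xs b x → (b , x) ∈ zip bs xs → b ≡ 0 → suc x ≤ minimalsBound bs xs
minimalsBound-≥ (b' ∷ bs) (x' ∷ xs) b x (here refl) refl = ℕP.m≤m⊔n (suc x) (minimalsBound bs xs)
minimalsBound-≥ (b' ∷ bs) (x' ∷ xs) b x (there p) e = ℕP.≤-trans (minimalsBound-≥ bs xs b x p e) (ℕP.m≤n⊔m _ (minimalsBound bs xs))

minimalsBound-≤ : ∀ bs xs T → (∀ b x → (b , x) ∈ zip bs xs → b ≡ 0 → suc x ≤ T) → minimalsBound bs xs ≤ T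
minimalsBound-≤ [] xs T h = z≤n
minimalsBound-≤ (b ∷ bs) [] T h = z≤n
minimalsBound-≤ (b ∷ bs) (x ∷ xs) T h = ℕP.⊔-lub head (minimalsBound-≤ bs xs T (λ b' x' p → h b' x' (there p)))
  where
  head : (if b ≡ᵇ 0 then suc x else 0) ≤ T
  head with b ≡ᵇ 0 in e
  ... | true = h b x (here refl) (≡ᵇ-sound b 0 e)
  ... | false = z≤n

linked-∷ : ∀ {x} xs → (∀ y → y ∈ xs → x < y) → Linked _<_ xs → Linked _<_ (x ∷ xs)
linked-∷ [] h L = [-]
linked-∷ (y ∷ xs) h L = h y (here refl) ∷ L

module Extension (bs : List ℕ) (M : ℕ) (Xs : List ℕ) (bs-sorted : Linked _≤_ bs) (r : Realises (map pred bs) M Xs) where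
  private module R = Realises r

  m fresh : ℕ
  m = minimalsBound bs Xs
  fresh = 2 * m + 1

  points : List ℕ
  points = fresh ∷ map (lift M) Xs

  length-Xs : length Xs ≡ length bs
  length-Xs = trans R.length≡ (List.length-map pred bs)

  degree-pred : ∀ b x → (b , x) ∈ zip bs Xs → downDegreeℕ M Xs x ≡ pred b
  degree-pred = map-≡⇒pointwise (downDegreeℕ M Xs) pred Xs bs R.degrees

  positive⇒m≤ : ∀ b x → (b , x) ∈ zip bs Xs → 1 ≤ b → m ≤ x
  positive⇒m≤ b x p b≥1 = minimalsBound-≤ bs Xs x below
    where
    ordered : AllPairs ZipOrdered (zip bs Xs)
    ordered = Linked.Linked⇒AllPairs ZipOrdered-trans (zip-linked bs Xs bs-sorted R.increasing)
    below : ∀ b₀ x₀ → (b₀ , x₀) ∈ zip bs Xs → b₀ ≡ 0 → suc x₀ ≤ x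
    below b₀ x₀ p₀ refl with allPairs-trichotomy ordered p₀ p
    ... | inj₁ refl = ⊥-elim (ℕP.<-irrefl refl b≥1)
    ... | inj₂ (inj₁ (_ , lt)) = lt
    ... | inj₂ (inj₂ (le , _)) = ⊥-elim (ℕP.<-irrefl refl (ℕP.≤-trans b≥1 le))

  -- A minimal point x₀ has no y with y + M < x₀, and y + M = x₀ is excluded by shift-disjoint.
  m≤+unit : ∀ y → y ∈ Xs → m ≤ y + M
  m≤+unit y y∈ = minimalsBound-≤ bs Xs (y + M) below
    where
    below : ∀ b₀ x₀ → (b₀ , x₀) ∈ zip bs Xs → b₀ ≡ 0 → suc x₀ ≤ y + M
    below b₀ x₀ p₀ refl with ℕP.m≤n⇒m<n∨m≡n (ℕP.≮⇒≥ not-below)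
      where
      not-below : ¬ (y + M < x₀)
      not-below lt with trans (sym (count≡0⇒false (λ Y → Y + M <ᵇ x₀) Xs (degree-pred 0 x₀ p₀) y y∈)) (<ᵇ-true lt)
      ... | ()
    ... | inj₁ lt = lt
    ... | inj₂ eq = ⊥-elim (R.shift-disjoint y x₀ y∈ (∈-zip⇒∈₂ p₀) (sym eq))

  fresh<lifted : ∀ y → y ∈ Xs → fresh < lift M y
  fresh<lifted y y∈ = fresh<lift M m y (m≤+unit y y∈)

  fresh≤points : ∀ v → v ∈ points → fresh ≤ v
  fresh≤points v (here refl) = ℕP.≤-refl
  fresh≤points v (there v∈) with ∈.∈-map⁻ (lift M) v∈
  ... | y , y∈ , refl = ℕP.<⇒≤ (fresh<lifted y y∈)

  points-increasing : Linked _<_ points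
  points-increasing = linked-∷ _ (λ v v∈ → case ∈.∈-map⁻ (lift M) v∈ of λ { (y , y∈ , refl) → fresh<lifted y y∈ })
    (Linked.map⁺ (Linked.map (lift-mono M) R.increasing))

  points-shift-disjoint : ∀ x y → x ∈ points → y ∈ points → x + 2 * M ≢ y
  points-shift-disjoint x y (here refl) (here refl) eq =
    ℕP.<-irrefl (sym eq) (ℕP.m<m+n fresh (ℕP.≤-trans R.unit-pos (ℕP.m≤n*m M 2)))
  points-shift-disjoint x y (here refl) (there y∈) eq with ∈.∈-map⁻ (lift M) y∈
  ... | z , _ , refl = fresh+≢lift M m z eq
  points-shift-disjoint x y (there x∈) (here refl) eq with ∈.∈-map⁻ (lift M) x∈
  ... | z , z∈ , refl = ℕP.<-irrefl (sym eq) (ℕP.<-≤-trans (fresh<lifted z z∈) (ℕP.m≤m+n (lift M z) (2 * M)))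
  points-shift-disjoint x y (there x∈) (there y∈) eq with ∈.∈-map⁻ (lift M) x∈ | ∈.∈-map⁻ (lift M) y∈
  ... | a , a∈ , refl | b , b∈ , refl = lift+≢lift M a b (R.shift-disjoint a b a∈ b∈) eq

  fresh-degree : downDegreeℕ (2 * M) points fresh ≡ 0
  fresh-degree = count-none (λ v → v + 2 * M <ᵇ fresh) points (λ v v∈ → <ᵇ-false (λ lt →
    ℕP.<-irrefl refl (ℕP.<-≤-trans lt (ℕP.≤-trans (fresh≤points v v∈) (ℕP.m≤m+n v (2 * M))))))

  lifted-degree : ∀ b x → (b , x) ∈ zip bs Xs → downDegreeℕ (2 * M) points (lift M x) ≡ b
  lifted-degree b x p = trans (cong (indicator (fresh + 2 * M <ᵇ lift M x) +_) old) (add-fresh b refl)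
    where
    old : count (λ v → v + 2 * M <ᵇ lift M x) (map (lift M) Xs) ≡ pred b
    old = trans (count-map _ (lift M) Xs)
      (trans (count-cong Xs (λ y _ → bool-ext (λ t → <ᵇ-true (Equivalence.to (lift-< M y x) (<ᵇ-sound t)))
                                             (λ t → <ᵇ-true (Equivalence.from (lift-< M y x) (<ᵇ-sound t)))))
             (degree-pred b x p))
    add-fresh : ∀ b' → b' ≡ b → indicator (fresh + 2 * M <ᵇ lift M x) + pred b ≡ b
    add-fresh zero refl rewrite <ᵇ-false (λ lt → ℕP.<-irrefl refl
      (ℕP.<-≤-trans (minimalsBound-≥ bs Xs 0 x p refl) (Equivalence.to (fresh-<-lift M m x) lt))) = refl
    add-fresh (suc b'') refl rewrite <ᵇ-true (Equivalence.from (fresh-<-lift M m x) (positive⇒m≤ (suc b'') x p (s≤s z≤n))) = refl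

  points-degrees : map (downDegreeℕ (2 * M) points) points ≡ 0 ∷ bs
  points-degrees = cong₂ _∷_ fresh-degree (begin
    map (downDegreeℕ (2 * M) points) (map (lift M) Xs) ≡⟨ List.map-∘ Xs ⟨
    map (downDegreeℕ (2 * M) points ∘ lift M) Xs      ≡⟨ pointwise⇒map-≡ _ Xs bs length-Xs lifted-degree ⟩
    bs                                                ∎)
    where open ≡-Reasoning

  extend-realises : Realises (0 ∷ bs) (2 * M) points
  extend-realises = record
    { unit-pos = ℕP.≤-trans R.unit-pos (ℕP.m≤n*m M 2)
    ; length≡ = cong suc (trans (List.length-map (lift M) Xs) length-Xs)
    ; increasing = points-increasing
    ; shift-disjoint = points-shift-disjoint
    ; degrees = points-degrees
    }

bounded-pred : ∀ k bs → Bounded (suc k) bs → Bounded k (map pred bs)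
bounded-pred k [] B = tt
bounded-pred k (b ∷ bs) (h , B) = ℕP.pred-mono-≤ h , bounded-pred (suc k) bs B

realise-realises : ∀ f bs → length bs ≤ f → Linked _≤_ bs → Bounded 0 bs → Realises bs (proj₁ (realise f bs)) (proj₂ (realise f bs))
realise-realises f [] le L B = record { unit-pos = s≤s z≤n ; length≡ = refl ; increasing = [] ; shift-disjoint = λ _ _ () ; degrees = refl }
realise-realises zero (b ∷ bs) () L B
realise-realises (suc f) (zero ∷ bs) (s≤s le) L (_ , B) =
  Extension.extend-realises bs _ _ (Linked.tail L)
    (realise-realises f (map pred bs) (subst (_≤ f) (sym (List.length-map pred bs)) le)
      (Linked.map⁺ (Linked.map ℕP.pred-mono-≤ (Linked.tail L))) (bounded-pred 0 bs B))

-- Dividing by M turns the unit M into the unit 1.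
module Rescaled (M : ℕ) .{{_ : NonZero M}} where
  scale : ℕ → ℚ
  scale X = fraction X M

  represents-scale+1 : ∀ X → Represents (scale X ℚ.+ 1ℚ) (X + M) M
  represents-scale+1 X = represents-rescale (M * 1) M {{ℕP.m*n≢0 M 1}}
    (represents-+ M 1 (represents-fraction X M) represents-1) (e X M)
    where
    e : ∀ X M → (X * 1 + 1 * M) * M ≡ (X + M) * (M * 1)
    e = solve-∀

  scale-< : ∀ {X Y} → X < Y → scale X ℚ.< scale Y
  scale-< {X} {Y} lt = represents-<⁻ M M (represents-fraction X M) (represents-fraction Y M) (ℕP.*-monoˡ-< M lt)

  scale+1<⇒ : ∀ Y X → scale Y ℚ.+ 1ℚ ℚ.< scale X → Y + M < X
  scale+1<⇒ Y X lt = ℕP.*-cancelʳ-< M (Y + M) X (represents-< M M (represents-scale+1 Y) (represents-fraction X M) lt)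

  scale+1<⇐ : ∀ Y X → Y + M < X → scale Y ℚ.+ 1ℚ ℚ.< scale X
  scale+1<⇐ Y X lt = represents-<⁻ M M (represents-scale+1 Y) (represents-fraction X M) (ℕP.*-monoˡ-< M lt)

  scale+1≡⇒ : ∀ X Y → scale X ℚ.+ 1ℚ ≡ scale Y → X + M ≡ Y
  scale+1≡⇒ X Y eq with ℕP.<-cmp (X + M) Y
  ... | tri< lt _ _ = ⊥-elim (ℚP.<-irrefl eq (scale+1<⇐ X Y lt))
  ... | tri≈ _ e _ = e
  ... | tri> _ _ gt = ⊥-elim (ℚP.<-irrefl (sym eq)
    (represents-<⁻ M M (represents-fraction Y M) (represents-scale+1 X) (ℕP.*-monoˡ-< M gt)))

  module _ {bs Xs : List ℕ} (r : Realises bs M Xs) where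
    private module R = Realises r

    scaled-good : Good (map scale Xs)
    scaled-good = Linked.map⁺ (Linked.map scale-< R.increasing) , disjoint
      where
      disjoint : ∀ x → x ∈ map scale Xs → (x ℚ.+ 1ℚ) ∉ map scale Xs
      disjoint x x∈ x+1∈ with ∈.∈-map⁻ scale x∈
      ... | X , X∈ , refl with ∈.∈-map⁻ scale x+1∈
      ... | Y , Y∈ , e = R.shift-disjoint X Y X∈ Y∈ (scale+1≡⇒ X Y e)

    scaled-downDegrees : downDegrees (map scale Xs) ≡ bs
    scaled-downDegrees = trans (sym (List.map-∘ Xs)) (trans (List.map-cong pointwise Xs) R.degrees)
      where
      pointwise : ∀ X → downDegree (map scale Xs) (scale X) ≡ downDegreeℕ M Xs X
      pointwise X = trans (count-map _ scale Xs) (count-cong Xs (λ Y _ → bool-ext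
        (λ t → <ᵇ-true (scale+1<⇒ Y X (ltᵇ-sound t))) (λ t → ltᵇ-true (scale+1<⇐ Y X (<ᵇ-sound t)))))

phiWord-surjective : ∀ n w → IsDyck n w → Σ (List ℚ) (λ S → Good S × length S ≡ n × phiWord S ≡ w)
phiWord-surjective n w (#N , #E , aboveDiag) = map scale Xs , scaled-good r , length-S , (begin
  phiWord (map scale Xs)                                ≡⟨ phiWord≡pathFrom _ (scaled-good r) ⟩
  pathFrom 0 (downDegrees (map scale Xs)) (length (map scale Xs)) ≡⟨ cong₂ (pathFrom 0) (scaled-downDegrees r) length-S ⟩
  pathFrom 0 bs n                                       ≡⟨ pathFrom-northColumns 0 w n (trans (ℕP.+-identityʳ (countE w)) #E) ⟩
  w                                                     ∎)
  where
  open ≡-Reasoning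
  bs : List ℕ
  bs = northColumns 0 w
  M : ℕ
  M = proj₁ (realise (length bs) bs)
  Xs : List ℕ
  Xs = proj₂ (realise (length bs) bs)
  r : Realises bs M Xs
  r = realise-realises (length bs) bs ℕP.≤-refl (Linked.tail (northColumns-sorted 0 w)) (northColumns-bounded 0 0 w z≤n aboveDiag)
  instance
    M≢0 : NonZero M
    M≢0 = ℕ.>-nonZero (Realises.unit-pos r)
  open Rescaled M
  length-S : length (map scale Xs) ≡ n
  length-S = trans (List.length-map _ Xs) (trans (Realises.length≡ r) (trans (length-northColumns 0 w) #N))


-- The coordinates of Ξ_poset

∨-true : ∀ {x y} → (x ∨ y) ≡ true → x ≡ true ⊎ y ≡ true
∨-true {true} _ = inj₁ refl
∨-true {false} e = inj₂ e

∨-true⁻ : ∀ {x y} → x ≡ true ⊎ y ≡ true → (x ∨ y) ≡ true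
∨-true⁻ {true} _ = refl
∨-true⁻ {false} (inj₂ e) = e

∧-true : ∀ {x y} → (x ∧ y) ≡ true → x ≡ true × y ≡ true
∧-true {true} e = refl , e

∧-true⁻ : ∀ {x y} → x ≡ true → y ≡ true → (x ∧ y) ≡ true
∧-true⁻ refl e = e

≡⇒≡ᵇ-true : ∀ {a b} → a ≡ b → (a ≡ᵇ b) ≡ true
≡⇒≡ᵇ-true {a} refl = ≡ᵇ-refl a

lexᵇ : List ℕ → List ℕ → Bool
lexᵇ [] [] = false
lexᵇ [] (_ ∷ _) = true
lexᵇ (_ ∷ _) [] = false
lexᵇ (a ∷ u) (b ∷ v) = (a <ᵇ b) ∨ ((a ≡ᵇ b) ∧ lexᵇ u v)

belowPathᵇ : List ℕ → List ℕ → Bool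
belowPathᵇ u v = (suc (length u) <ᵇ length v) ∨ ((suc (length u) ≡ᵇ length v) ∧ lexᵇ u v)

radix-< : ∀ a b K X Y → X < K → Y < K → (a * K + X < b * K + Y) ⇔ ((a < b) ⊎ (a ≡ b × X < Y))
radix-< a b K X Y X<K Y<K = mk⇔ fw bw
  where
  up : ∀ a b Z → a < b → Z < K → a * K + Z < b * K
  up a b Z a<b Z<K = ℕP.<-≤-trans (ℕP.+-monoʳ-< (a * K) Z<K)
    (ℕP.≤-trans (ℕP.≤-reflexive (ℕP.+-comm (a * K) K)) (ℕP.*-monoˡ-≤ K a<b))
  fw : a * K + X < b * K + Y → (a < b) ⊎ (a ≡ b × X < Y)
  fw lt with ℕP.<-cmp a b
  ... | tri< p _ _ = inj₁ p
  ... | tri≈ _ refl _ = inj₂ (refl , ℕP.+-cancelˡ-< (a * K) X Y lt)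
  ... | tri> _ _ p = ⊥-elim (ℕP.<-asym lt (ℕP.<-≤-trans (up b a Y p Y<K) (ℕP.m≤m+n (a * K) X)))
  bw : (a < b) ⊎ (a ≡ b × X < Y) → a * K + X < b * K + Y
  bw (inj₁ p) = ℕP.<-≤-trans (up a b X p X<K) (ℕP.m≤m+n (b * K) Y)
  bw (inj₂ (refl , p)) = ℕP.+-monoʳ-< (a * K) p

DigitsIn : ℕ → List ℕ → Set
DigitsIn k = All (λ c → 1 ≤ c × c ≤ k)

-- Digits c ∈ [1, m] in base m + 2: the coordinate x_u of Ξ_poset is |u| + value u / B ^ |u|.
module Digits (m : ℕ) where
  B : ℕ
  B = suc (suc m)

  value : List ℕ → ℕ
  value [] = 0
  value (c ∷ cs) = c * B ^ length cs + value cs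

  value< : ∀ cs → DigitsIn m cs → value cs < B ^ length cs
  value< [] _ = s≤s z≤n
  value< (c ∷ cs) ((_ , c≤m) ∷ D) = ℕP.<-≤-trans (ℕP.+-monoʳ-< (c * B ^ length cs) (value< cs D))
    (ℕP.≤-trans (ℕP.≤-reflexive (ℕP.+-comm (c * B ^ length cs) (B ^ length cs)))
      (ℕP.*-monoˡ-≤ (B ^ length cs) (s≤s (ℕP.≤-trans c≤m (ℕP.n≤1+n m)))))

  value-pos : ∀ b v → DigitsIn m (b ∷ v) → 1 ≤ value (b ∷ v)
  value-pos b v ((b≥1 , _) ∷ _) = ℕP.≤-trans (ℕP.*-mono-≤ b≥1 (ℕP.m^n>0 B (length v))) (ℕP.m≤m+n (b * B ^ length v) (value v))

  lex⇔value-< : ∀ u v → DigitsIn m u → DigitsIn m v → (lexᵇ u v ≡ true) ⇔ (value u * B ^ length v < value v * B ^ length u)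
  lex⇔value-< [] [] _ _ = mk⇔ (λ ()) (λ ())
  lex⇔value-< [] (b ∷ v) _ Dv = mk⇔ (λ _ → ℕP.≤-trans (value-pos b v Dv) (ℕP.≤-reflexive (sym (ℕP.*-identityʳ _)))) (λ _ → refl)
  lex⇔value-< (a ∷ u) [] _ _ = mk⇔ (λ ()) (λ lt → ⊥-elim (ℕP.n≮0 lt))
  lex⇔value-< (a ∷ u) (b ∷ w) ((a1 , am) ∷ Du) ((b1 , bm) ∷ Dw) = mk⇔ fw bw
    where
    Pu : ℕ
    Pu = B ^ length u
    Pw : ℕ
    Pw = B ^ length w
    K : ℕ
    K = Pu * Pw
    X : ℕ
    X = value u * Pw
    Y : ℕ
    Y = value w * Pu
    X<K : X < K
    X<K = ℕP.*-monoˡ-< Pw {{ℕP.m^n≢0 B (length w)}} (value< u Du)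
    Y<K : Y < K
    Y<K = subst (Y <_) (ℕP.*-comm Pw Pu) (ℕP.*-monoˡ-< Pu {{ℕP.m^n≢0 B (length u)}} (value< w Dw))
    e1 : ∀ a Pu Vu B Pw → (a * Pu + Vu) * (B * Pw) ≡ B * (a * (Pu * Pw) + Vu * Pw)
    e1 = solve-∀
    e2 : ∀ b Pw Vw B Pu → (b * Pw + Vw) * (B * Pu) ≡ B * (b * (Pu * Pw) + Vw * Pu)
    e2 = solve-∀
    canc : (value (a ∷ u) * B ^ length (b ∷ w) < value (b ∷ w) * B ^ length (a ∷ u)) ⇔ (a * K + X < b * K + Y)
    canc = mk⇔ (λ lt → ℕP.*-cancelˡ-< B _ _ (subst₂ _<_ (e1 a Pu (value u) B Pw) (e2 b Pw (value w) B Pu) lt))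
               (λ lt → subst₂ _<_ (sym (e1 a Pu (value u) B Pw)) (sym (e2 b Pw (value w) B Pu)) (ℕP.*-monoʳ-< B lt))
    IH : (lexᵇ u w ≡ true) ⇔ (value u * B ^ length w < value w * B ^ length u)
    IH = lex⇔value-< u w Du Dw
    fw : lexᵇ (a ∷ u) (b ∷ w) ≡ true → value (a ∷ u) * B ^ length (b ∷ w) < value (b ∷ w) * B ^ length (a ∷ u)
    fw e = Equivalence.from canc (Equivalence.from (radix-< a b K X Y X<K Y<K) (h (∨-true e)))
      where
      h : (a <ᵇ b) ≡ true ⊎ ((a ≡ᵇ b) ∧ lexᵇ u w) ≡ true → (a < b) ⊎ (a ≡ b × X < Y)
      h (inj₁ p) = inj₁ (<ᵇ-sound p)
      h (inj₂ p) with ∧-true {a ≡ᵇ b} p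
      ... | p1 , p2 = inj₂ (≡ᵇ-sound a b p1 , Equivalence.to IH p2)
    bw : value (a ∷ u) * B ^ length (b ∷ w) < value (b ∷ w) * B ^ length (a ∷ u) → lexᵇ (a ∷ u) (b ∷ w) ≡ true
    bw lt with Equivalence.to (radix-< a b K X Y X<K Y<K) (Equivalence.to canc lt)
    ... | inj₁ p = ∨-true⁻ (inj₁ (<ᵇ-true p))
    ... | inj₂ (refl , p) = ∨-true⁻ {a <ᵇ a} (inj₂ (∧-true⁻ (≡ᵇ-refl a) (Equivalence.from IH p)))

  weightedSum-represents : ∀ i cs → Represents (weightedSum m (suc i) cs) (value cs) (B ^ (i + length cs))
  weightedSum-represents i [] = represents-rescale {0ℚ} {0} {0} 1 (B ^ (i + 0)) {{ℕ.>-nonZero (s≤s z≤n)}} {{ℕP.m^n≢0 B (i + 0)}} represents-0 refl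
  weightedSum-represents i (c ∷ cs) = represents-rescale (B ^ suc i * B ^ (suc i + k)) (B ^ (i + suc k))
      {{ℕP.m*n≢0 (B ^ suc i) (B ^ (suc i + k)) {{ℕP.m^n≢0 B (suc i)}} {{ℕP.m^n≢0 B (suc i + k)}}}} {{ℕP.m^n≢0 B (i + suc k)}}
      (represents-+ (B ^ suc i) (B ^ (suc i + k)) {{ℕP.m^n≢0 B (suc i)}} {{ℕP.m^n≢0 B (suc i + k)}}
        (represents-fraction c (B ^ suc i) {{ℕP.m^n≢0 B (suc i)}}) (weightedSum-represents (suc i) cs))
      cross
    where
    k : ℕ
    k = length cs
    P : ℕ
    P = B ^ suc i
    Qk : ℕ
    Qk = B ^ k
    pw1 : B ^ (suc i + k) ≡ P * Qk
    pw1 = ℕP.^-distribˡ-+-* B (suc i) k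
    pw2 : B ^ (i + suc k) ≡ P * Qk
    pw2 = trans (cong (B ^_) (ℕP.+-suc i k)) pw1
    e : ∀ c P Qk Vc → (c * (P * Qk) + Vc * P) * (P * Qk) ≡ (c * Qk + Vc) * (P * (P * Qk))
    e = solve-∀
    cross : (c * B ^ (suc i + k) + value cs * B ^ suc i) * B ^ (i + suc k) ≡ (c * B ^ k + value cs) * (B ^ suc i * B ^ (suc i + k))
    cross rewrite pw1 | pw2 = e c P Qk (value cs)

  xCoord-represents : ∀ cs → Represents (xCoord m cs) (length cs * B ^ length cs + value cs) (B ^ length cs)
  xCoord-represents cs = represents-rescale (1 * D) D {{ℕP.m*n≢0 1 D {{ℕ.>-nonZero (s≤s z≤n)}} {{ℕP.m^n≢0 B (length cs)}}}} {{ℕP.m^n≢0 B (length cs)}}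
    (represents-+ 1 D {{ℕ.>-nonZero (s≤s z≤n)}} {{ℕP.m^n≢0 B (length cs)}} (represents-fraction (length cs) 1) (weightedSum-represents 0 cs))
    (e (length cs) D (value cs))
    where
    D : ℕ
    D = B ^ length cs
    e : ∀ l D Vc → (l * D + Vc * 1) * D ≡ (l * D + Vc) * (1 * D)
    e = solve-∀

  xCoord+1-represents : ∀ cs → Represents (xCoord m cs ℚ.+ 1ℚ) (suc (length cs) * B ^ length cs + value cs) (B ^ length cs)
  xCoord+1-represents cs = represents-rescale (D * 1) D {{ℕP.m*n≢0 D 1 {{ℕP.m^n≢0 B (length cs)}} {{ℕ.>-nonZero (s≤s z≤n)}}}} {{ℕP.m^n≢0 B (length cs)}}
    (represents-+ D 1 {{ℕP.m^n≢0 B (length cs)}} {{ℕ.>-nonZero (s≤s z≤n)}} (xCoord-represents cs) represents-1) (e (length cs) D (value cs))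
    where
    D : ℕ
    D = B ^ length cs
    e : ∀ l D Vc → ((l * D + Vc) * 1 + 1 * D) * D ≡ (suc l * D + Vc) * (D * 1)
    e = solve-∀

  xCoord-below : ∀ u v → DigitsIn m u → DigitsIn m v → ltᵇ (xCoord m u ℚ.+ 1ℚ) (xCoord m v) ≡ belowPathᵇ u v
  xCoord-below u v Du Dv = bool-ext fw bw
    where
    Du' : ℕ
    Du' = B ^ length u
    Dv' : ℕ
    Dv' = B ^ length v
    K : ℕ
    K = Du' * Dv'
    X : ℕ
    X = value u * Dv'
    Y : ℕ
    Y = value v * Du'
    X<K : X < K
    X<K = ℕP.*-monoˡ-< Dv' {{ℕP.m^n≢0 B (length v)}} (value< u Du)
    Y<K : Y < K
    Y<K = subst (Y <_) (ℕP.*-comm Dv' Du') (ℕP.*-monoˡ-< Du' {{ℕP.m^n≢0 B (length u)}} (value< v Dv))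
    e1 : ∀ a Du Vu Dv → (a * Du + Vu) * Dv ≡ a * (Du * Dv) + Vu * Dv
    e1 = solve-∀
    e2 : ∀ b Dv Vv Du → (b * Dv + Vv) * Du ≡ b * (Du * Dv) + Vv * Du
    e2 = solve-∀
    G : (suc (length u) * K + X < length v * K + Y) ⇔ ((suc (length u) < length v) ⊎ (suc (length u) ≡ length v × X < Y))
    G = radix-< (suc (length u)) (length v) K X Y X<K Y<K
    fw : ltᵇ (xCoord m u ℚ.+ 1ℚ) (xCoord m v) ≡ true → belowPathᵇ u v ≡ true
    fw t with Equivalence.to G (subst₂ _<_ (e1 (suc (length u)) Du' (value u) Dv') (e2 (length v) Dv' (value v) Du')
                (represents-< Du' Dv' {{ℕP.m^n≢0 B (length u)}} {{ℕP.m^n≢0 B (length v)}} (xCoord+1-represents u) (xCoord-represents v) (ltᵇ-sound t)))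
    ... | inj₁ p = ∨-true⁻ (inj₁ (<ᵇ-true p))
    ... | inj₂ (p , q) = ∨-true⁻ {suc (length u) <ᵇ length v} (inj₂ (∧-true⁻ (≡⇒≡ᵇ-true p) (Equivalence.from (lex⇔value-< u v Du Dv) q)))
    bw : belowPathᵇ u v ≡ true → ltᵇ (xCoord m u ℚ.+ 1ℚ) (xCoord m v) ≡ true
    bw r = ltᵇ-true (represents-<⁻ Du' Dv' {{ℕP.m^n≢0 B (length u)}} {{ℕP.m^n≢0 B (length v)}} (xCoord+1-represents u) (xCoord-represents v)
      (subst₂ _<_ (sym (e1 (suc (length u)) Du' (value u) Dv')) (sym (e2 (length v) Dv' (value v) Du')) (Equivalence.from G (h (∨-true r)))))
      where
      h : (suc (length u) <ᵇ length v) ≡ true ⊎ ((suc (length u) ≡ᵇ length v) ∧ lexᵇ u v) ≡ true →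
          (suc (length u) < length v) ⊎ (suc (length u) ≡ length v × X < Y)
      h (inj₁ p) = inj₁ (<ᵇ-sound p)
      h (inj₂ p) with ∧-true {suc (length u) ≡ᵇ length v} p
      ... | p1 , p2 = inj₂ (≡ᵇ-sound _ _ p1 , Equivalence.to (lex⇔value-< u v Du Dv) p2)


-- Levels of a plane tree

-- Nodes are addressed by their c-paths [c(u₁), …, c(u_d)], as in cPathsT.
Path : Set
Path = List ℕ

zipConcat : ∀ {A : Set} → List (List A) → List (List A) → List (List A)
zipConcat [] ys = ys
zipConcat (x ∷ xs) [] = x ∷ xs
zipConcat (x ∷ xs) (y ∷ ys) = (x ++ y) ∷ zipConcat xs ys

mutual
  pathLevels : PTree → List (List Path)
  pathLevels (node ts) = ([] ∷ []) ∷ pathLevelsF ts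

  pathLevelsF : List PTree → List (List Path)
  pathLevelsF [] = []
  pathLevelsF (t ∷ ts) = zipConcat (map (map (suc (length ts) ∷_)) (pathLevels t)) (pathLevelsF ts)

mutual
  arity : PTree → Path → ℕ
  arity (node ts) [] = length ts
  arity (node ts) (c ∷ p) = arityF ts c p

  arityF : List PTree → ℕ → Path → ℕ
  arityF [] c p = 0
  arityF (t ∷ ts) c p = if c ≡ᵇ suc (length ts) then arity t p else arityF ts c p

-- The order in which Ξ_bounce reads the nodes: by depth, right to left within a depth.
bounceOrder : PTree → List Path
bounceOrder T = concat (map reverse (pathLevels T))

HeadIn : ℕ → Path → Set
HeadIn k [] = ⊥
HeadIn k (c ∷ _) = 1 ≤ c × c ≤ k

mutual
  cPathsT-prefix : ∀ p t → cPathsT p t ≡ map (p ++_) (cPathsT [] t)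
  cPathsT-prefix p (node ts) = cPathsF-prefix p ts

  cPathsF-prefix : ∀ p ts → cPathsF p ts ≡ map (p ++_) (cPathsF [] ts)
  cPathsF-prefix p [] = refl
  cPathsF-prefix p (t ∷ ts) = cong ((p ++ c ∷ []) ∷_) (trans (cong₂ _++_ e1 (cPathsF-prefix p ts)) (sym (List.map-++ (p ++_) (cPathsT (c ∷ []) t) (cPathsF [] ts))))
    where
    c : ℕ
    c = suc (length ts)
    e1 : cPathsT (p ++ c ∷ []) t ≡ map (p ++_) (cPathsT (c ∷ []) t)
    e1 = trans (cPathsT-prefix (p ++ c ∷ []) t) (trans (List.map-cong (λ w → List.++-assoc p (c ∷ []) w) (cPathsT [] t))
           (trans (List.map-∘ (cPathsT [] t)) (cong (map (p ++_)) (sym (cPathsT-prefix (c ∷ []) t)))))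

cPathsF-∷ : ∀ t ts → cPathsF [] (t ∷ ts) ≡ (suc (length ts) ∷ []) ∷ map (suc (length ts) ∷_) (cPathsT [] t) ++ cPathsF [] ts
cPathsF-∷ t ts = cong (λ z → (suc (length ts) ∷ []) ∷ z ++ cPathsF [] ts) (cPathsT-prefix (suc (length ts) ∷ []) t)

mutual
  length-cPathsT : ∀ t → length (cPathsT [] t) ≡ size t
  length-cPathsT (node ts) = length-cPathsF ts

  length-cPathsF : ∀ ts → length (cPathsF [] ts) ≡ sizeF ts
  length-cPathsF [] = refl
  length-cPathsF (t ∷ ts) = cong suc (trans (cong length (cong (_++ cPathsF [] ts) (cPathsT-prefix (suc (length ts) ∷ []) t)))
    (trans (List.length-++ (map (suc (length ts) ∷_) (cPathsT [] t))) (cong₂ _+_ (trans (List.length-map _ (cPathsT [] t)) (length-cPathsT t)) (length-cPathsF ts))))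

cPathsF-heads : ∀ ts → All (HeadIn (length ts)) (cPathsF [] ts)
cPathsF-heads [] = []
cPathsF-heads (t ∷ ts) = subst (All (HeadIn (suc (length ts)))) (sym (cPathsF-∷ t ts))
  ((s≤s z≤n , ℕP.≤-refl) ∷ All.++⁺ (All.map⁺ (All.tabulate (λ _ → s≤s z≤n , ℕP.≤-refl)))
     (All.map (λ {u} → weak u) (cPathsF-heads ts)))
  where
  weak : ∀ u → HeadIn (length ts) u → HeadIn (suc (length ts)) u
  weak (c ∷ _) (a , b) = a , ℕP.≤-trans b (ℕP.n≤1+n _)

concat-zipConcat-↭ : ∀ {A : Set} (xss yss : List (List A)) → concat (zipConcat xss yss) ↭ concat xss ++ concat yss
concat-zipConcat-↭ [] yss = ↭.↭-refl
concat-zipConcat-↭ (xs ∷ xss) [] = ↭.↭-reflexive (sym (List.++-identityʳ _))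
concat-zipConcat-↭ (xs ∷ xss) (ys ∷ yss) = begin
  (xs ++ ys) ++ concat (zipConcat xss yss) ↭⟨ ↭.++⁺ˡ (xs ++ ys) (concat-zipConcat-↭ xss yss) ⟩
  (xs ++ ys) ++ concat xss ++ concat yss   ≡⟨ List.++-assoc xs ys _ ⟩
  xs ++ ys ++ concat xss ++ concat yss     ↭⟨ ↭.++⁺ˡ xs (↭.shifts ys (concat xss)) ⟩
  xs ++ concat xss ++ ys ++ concat yss     ≡⟨ List.++-assoc xs (concat xss) _ ⟨
  (xs ++ concat xss) ++ ys ++ concat yss   ∎
  where open ↭.PermutationReasoning

concat-reverse-↭ : ∀ {A : Set} (xss : List (List A)) → concat (map reverse xss) ↭ concat xss
concat-reverse-↭ [] = ↭.↭-refl
concat-reverse-↭ (xs ∷ xss) = ↭.++⁺ (↭.↭-reverse xs) (concat-reverse-↭ xss)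

mutual
  pathLevels-↭ : ∀ t → concat (pathLevels t) ↭ [] ∷ cPathsT [] t
  pathLevels-↭ (node ts) = prep [] (pathLevelsF-↭ ts)

  pathLevelsF-↭ : ∀ ts → concat (pathLevelsF ts) ↭ cPathsF [] ts
  pathLevelsF-↭ [] = ↭.↭-refl
  pathLevelsF-↭ (t ∷ ts) = begin
    concat (zipConcat (map (map (c ∷_)) (pathLevels t)) (pathLevelsF ts)) ↭⟨ concat-zipConcat-↭ (map (map (c ∷_)) (pathLevels t)) (pathLevelsF ts) ⟩
    concat (map (map (c ∷_)) (pathLevels t)) ++ concat (pathLevelsF ts)   ≡⟨ cong (_++ _) (List.concat-map (pathLevels t)) ⟩
    map (c ∷_) (concat (pathLevels t)) ++ concat (pathLevelsF ts)         ↭⟨ ↭.++⁺ (↭.map⁺ (c ∷_) (pathLevels-↭ t)) (pathLevelsF-↭ ts) ⟩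
    map (c ∷_) ([] ∷ cPathsT [] t) ++ cPathsF [] ts                         ≡⟨ cPathsF-∷ t ts ⟨
    cPathsF [] (t ∷ ts)                                                    ∎
    where
    open ↭.PermutationReasoning
    c : ℕ
    c = suc (length ts)

bounceOrder-↭ : ∀ T → bounceOrder T ↭ [] ∷ cPathsT [] T
bounceOrder-↭ T = ↭-trans (concat-reverse-↭ (pathLevels T)) (pathLevels-↭ T)

length-bounceOrder : ∀ T → length (bounceOrder T) ≡ suc (size T)
length-bounceOrder T = trans (↭.↭-length (bounceOrder-↭ T)) (cong suc (length-cPathsT T))

pathLevelsF-heads : ∀ ts → All (HeadIn (length ts)) (concat (pathLevelsF ts))
pathLevelsF-heads ts = ↭.All-resp-↭ (↭-sym (pathLevelsF-↭ ts)) (cPathsF-heads ts)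

zipConcat-map : ∀ (f : Path → ℕ) xs ys → map (map f) (zipConcat xs ys) ≡ zipLevels (map (map f) xs) (map (map f) ys)
zipConcat-map f [] ys = refl
zipConcat-map f (x ∷ xs) [] = refl
zipConcat-map f (x ∷ xs) (y ∷ ys) = cong₂ _∷_ (List.map-++ f x y) (zipConcat-map f xs ys)

mapmap-cong : ∀ (f g : Path → ℕ) xss → All (λ u → f u ≡ g u) (concat xss) → map (map f) xss ≡ map (map g) xss
mapmap-cong f g [] _ = refl
mapmap-cong f g (x ∷ xss) h = let (h1 , h2) = All.++⁻ x h in cong₂ _∷_ (List.map-cong-local h1) (mapmap-cong f g xss h2)

mapmap-∘ : ∀ (f : Path → ℕ) (g : Path → Path) xss → map (map f) (map (map g) xss) ≡ map (map (f ∘ g)) xss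
mapmap-∘ f g [] = refl
mapmap-∘ f g (x ∷ xss) = cong₂ _∷_ (sym (List.map-∘ x)) (mapmap-∘ f g xss)

mutual
  levels-arity : ∀ t → map (map (arity t)) (pathLevels t) ≡ levelsT t
  levels-arity (node ts) = cong ((length ts ∷ []) ∷_) (levelsF-arity ts)

  levelsF-arity : ∀ ts → map (map (arity (node ts))) (pathLevelsF ts) ≡ levelsF ts
  levelsF-arity [] = refl
  levelsF-arity (t ∷ ts) = trans (zipConcat-map f (map (map (c ∷_)) (pathLevels t)) (pathLevelsF ts))
    (cong₂ zipLevels
      (trans (mapmap-∘ f (c ∷_) (pathLevels t))
        (trans (mapmap-cong (f ∘ (c ∷_)) (arity t) (pathLevels t) (All.tabulate (λ {u} _ → e1 u))) (levels-arity t)))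
      (trans (mapmap-cong f (arity (node ts)) (pathLevelsF ts) (All.map (λ {u} h → e2 u h) (pathLevelsF-heads ts)))
        (levelsF-arity ts)))
    where
    c : ℕ
    c = suc (length ts)
    f : Path → ℕ
    f = arity (node (t ∷ ts))
    e1 : ∀ u → f (c ∷ u) ≡ arity t u
    e1 u rewrite ≡ᵇ-refl c = refl
    e2 : ∀ u → HeadIn (length ts) u → f u ≡ arity (node ts) u
    e2 (d ∷ u) (_ , d≤) rewrite ≡ᵇ-false d c (λ eq → ℕP.<-irrefl eq (s≤s d≤)) = refl

bounceCounts≡arities : ∀ T → bounceCounts T ≡ map (arity T) (bounceOrder T)
bounceCounts≡arities T = begin
  concat (map reverse (levelsT T)) ≡⟨ cong (λ z → concat (map reverse z)) (sym (levels-arity T)) ⟩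
  concat (map reverse (map (map (arity T)) (pathLevels T))) ≡⟨ cong concat (mr (pathLevels T)) ⟩
  concat (map (map (arity T)) (map reverse (pathLevels T))) ≡⟨ List.concat-map (map reverse (pathLevels T)) ⟩
  map (arity T) (bounceOrder T) ∎
  where
  open ≡-Reasoning
  mr : ∀ xss → map reverse (map (map (arity T)) xss) ≡ map (map (arity T)) (map reverse xss)
  mr [] = refl
  mr (x ∷ xss) = cong₂ _∷_ (sym (List.reverse-map (arity T) x)) (mr xss)

pathEqᵇ : Path → Path → Bool
pathEqᵇ [] [] = true
pathEqᵇ [] (_ ∷ _) = false
pathEqᵇ (_ ∷ _) [] = false
pathEqᵇ (a ∷ u) (b ∷ w) = (a ≡ᵇ b) ∧ pathEqᵇ u w

shortlexᵇ : Path → Path → Bool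
shortlexᵇ u w = (length u <ᵇ length w) ∨ ((length u ≡ᵇ length w) ∧ lexᵇ u w)

Shortlex< : Path → Path → Set
Shortlex< u w = shortlexᵇ u w ≡ true

shortlex≤ᵇ : Path → Path → Bool
shortlex≤ᵇ u w = shortlexᵇ u w ∨ pathEqᵇ u w

-- Since c counts from the right, each level lists its paths in decreasing lexicographic order.
LevelsSorted : ℕ → List (List Path) → Set
LevelsSorted ℓ [] = ⊤
LevelsSorted ℓ (x ∷ xs) = All (λ u → length u ≡ ℓ) x × AllPairs (λ u w → lexᵇ w u ≡ true) x × LevelsSorted (suc ℓ) xs

<ᵇ-irrefl : ∀ n → (n <ᵇ n) ≡ false
<ᵇ-irrefl zero = refl
<ᵇ-irrefl (suc n) = <ᵇ-irrefl n

lex-∷ : ∀ c u w → lexᵇ (c ∷ u) (c ∷ w) ≡ lexᵇ u w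
lex-∷ c u w rewrite <ᵇ-irrefl c | ≡ᵇ-refl c = refl

levelsSorted-shift : ∀ c ℓ xss → LevelsSorted ℓ xss → LevelsSorted (suc ℓ) (map (map (c ∷_)) xss)
levelsSorted-shift c ℓ [] _ = tt
levelsSorted-shift c ℓ (x ∷ xss) (l , ap , ok) =
  All.map⁺ (All.map (cong suc) l) ,
  AllPairs.map⁺ (AllPairs.map (λ {u} {w} e → trans (lex-∷ c w u) e) ap) ,
  levelsSorted-shift c (suc ℓ) xss ok

levelsSorted-zipConcat : ∀ ℓ xs ys → LevelsSorted ℓ xs → LevelsSorted ℓ ys →
  (∀ u w → u ∈ concat xs → w ∈ concat ys → lexᵇ w u ≡ true) → LevelsSorted ℓ (zipConcat xs ys)
levelsSorted-zipConcat ℓ [] ys _ oky _ = oky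
levelsSorted-zipConcat ℓ (x ∷ xs) [] okx _ _ = okx
levelsSorted-zipConcat ℓ (x ∷ xs) (y ∷ ys) (lx , apx , okx) (ly , apy , oky) cr =
  All.++⁺ lx ly ,
  AllPairs.++⁺ apx apy (All.tabulate (λ {u} u∈ → All.tabulate (λ {w} w∈ → cr u w (∈.∈-++⁺ˡ u∈) (∈.∈-++⁺ˡ w∈)))) ,
  levelsSorted-zipConcat (suc ℓ) xs ys okx oky (λ u w u∈ w∈ → cr u w (∈.∈-++⁺ʳ x u∈) (∈.∈-++⁺ʳ y w∈))

mutual
  pathLevels-sorted : ∀ t → LevelsSorted 0 (pathLevels t)
  pathLevels-sorted (node ts) = (refl ∷ []) , ([] ∷ []) , pathLevelsF-sorted ts

  pathLevelsF-sorted : ∀ ts → LevelsSorted 1 (pathLevelsF ts)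
  pathLevelsF-sorted [] = tt
  pathLevelsF-sorted (t ∷ ts) = levelsSorted-zipConcat 1 (map (map (c ∷_)) (pathLevels t)) (pathLevelsF ts)
    (levelsSorted-shift c 0 (pathLevels t) (pathLevels-sorted t)) (pathLevelsF-sorted ts) cr
    where
    c : ℕ
    c = suc (length ts)
    cr : ∀ u w → u ∈ concat (map (map (c ∷_)) (pathLevels t)) → w ∈ concat (pathLevelsF ts) → lexᵇ w u ≡ true
    cr u w u∈ w∈ with ∈.∈-map⁻ (c ∷_) (subst (u ∈_) (List.concat-map (pathLevels t)) u∈)
    ... | u' , _ , refl = hd w (All.lookup (pathLevelsF-heads ts) w∈)
      where
      hd : ∀ w → HeadIn (length ts) w → lexᵇ w (c ∷ u') ≡ true
      hd (d ∷ w') (_ , d≤) rewrite <ᵇ-true {d} {c} (s≤s d≤) = refl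

All-reverse : ∀ {A : Set} {P : A → Set} {xs : List A} → All P xs → All P (reverse xs)
All-reverse {xs = xs} = ↭.All-resp-↭ (↭-sym (↭.↭-reverse xs))

AllPairs-reverse : ∀ {A : Set} {R : A → A → Set} {xs : List A} → AllPairs R xs → AllPairs (λ u w → R w u) (reverse xs)
AllPairs-reverse [] = []
AllPairs-reverse {R = R} {x ∷ xs} (h ∷ ap) = subst (AllPairs (λ u w → R w u)) (sym (List.unfold-reverse x xs))
  (AllPairs.++⁺ (AllPairs-reverse ap) ([] ∷ []) (All-reverse (All.map (λ r → r ∷ []) h)))

AllPairs-weaken : ∀ {A : Set} {R R' : A → A → Set} {P : A → Set} {xs : List A} → AllPairs R xs → All P xs →
  (∀ {u w} → P u → P w → R u w → R' u w) → AllPairs R' xs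
AllPairs-weaken [] [] f = []
AllPairs-weaken (h ∷ ap) (p ∷ ps) f = All.zipWith (λ { (r , q) → f p q r }) (h , ps) ∷ AllPairs-weaken ap ps f

levelsSorted-length : ∀ ℓ xss → LevelsSorted ℓ xss → All (λ w → ℓ ≤ length w) (concat (map reverse xss))
levelsSorted-length ℓ [] _ = []
levelsSorted-length ℓ (x ∷ xss) (l , _ , ok) = All.++⁺ (All-reverse (All.map (λ e → ℕP.≤-reflexive (sym e)) l))
  (All.map (λ le → ℕP.≤-trans (ℕP.n≤1+n ℓ) le) (levelsSorted-length (suc ℓ) xss ok))

levelsSorted⇒shortlex : ∀ ℓ xss → LevelsSorted ℓ xss → AllPairs Shortlex< (concat (map reverse xss))
levelsSorted⇒shortlex ℓ [] _ = []
levelsSorted⇒shortlex ℓ (x ∷ xss) (l , ap , ok) =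
  AllPairs.++⁺ (AllPairs-weaken {R' = Shortlex<} (AllPairs-reverse ap) (All-reverse l) (λ {u} {w} → sameLevel {u} {w}))
    (levelsSorted⇒shortlex (suc ℓ) xss ok)
    (All.map (λ {u} e → All.map (λ {w} → deeper {u} {w} e) (levelsSorted-length (suc ℓ) xss ok)) (All-reverse l))
  where
  sameLevel : ∀ {u w} → length u ≡ ℓ → length w ≡ ℓ → lexᵇ u w ≡ true → Shortlex< u w
  sameLevel {u} {w} e1 e2 lx rewrite e1 | e2 | <ᵇ-irrefl ℓ | ≡ᵇ-refl ℓ = lx
  deeper : ∀ {u w} → length u ≡ ℓ → suc ℓ ≤ length w → Shortlex< u w
  deeper {u} {w} e le = ∨-true⁻ (inj₁ (<ᵇ-true (subst (_< length w) (sym e) le)))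

bounceOrder-sorted : ∀ T → AllPairs Shortlex< (bounceOrder T)
bounceOrder-sorted T = levelsSorted⇒shortlex 0 (pathLevels T) (pathLevels-sorted T)

parent : Path → Path
parent [] = []
parent (x ∷ []) = []
parent (x ∷ y ∷ xs) = x ∷ parent (y ∷ xs)

lastStep : Path → ℕ
lastStep [] = 0
lastStep (x ∷ []) = x
lastStep (x ∷ y ∷ xs) = lastStep (y ∷ xs)

parent-snoc : ∀ p c → parent (p ++ c ∷ []) ≡ p
parent-snoc [] c = refl
parent-snoc (x ∷ []) c = refl
parent-snoc (x ∷ y ∷ p) c = cong (x ∷_) (parent-snoc (y ∷ p) c)

parent-snoc⁻ : ∀ v → v ≢ [] → v ≡ parent v ++ lastStep v ∷ []
parent-snoc⁻ [] ne = ⊥-elim (ne refl)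
parent-snoc⁻ (x ∷ []) ne = refl
parent-snoc⁻ (x ∷ y ∷ v) ne = cong (x ∷_) (parent-snoc⁻ (y ∷ v) (λ ()))

snoc≢[] : ∀ (p : Path) (c : ℕ) → p ++ c ∷ [] ≢ []
snoc≢[] [] c ()
snoc≢[] (x ∷ p) c ()

parent-closed : ∀ p ts v → v ∈ cPathsF p ts → parent v ∈ p ∷ cPathsF p ts
parent-closed p (node ch ∷ ts) v (here refl) = here (parent-snoc p (suc (length ts)))
parent-closed p (node ch ∷ ts) v (there v∈) with ∈.∈-++⁻ (cPathsF (p ++ suc (length ts) ∷ []) ch) v∈
... | inj₁ v∈1 with parent-closed (p ++ suc (length ts) ∷ []) ch v v∈1
...   | here e = there (here e)
...   | there w = there (there (∈.∈-++⁺ˡ w))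
parent-closed p (node ch ∷ ts) v (there v∈) | inj₂ v∈2 with parent-closed p ts v v∈2
...   | here e = here e
...   | there w = there (there (∈.∈-++⁺ʳ (cPathsF (p ++ suc (length ts) ∷ []) ch) w))

cPathsF-nonEmpty : ∀ p ts → All (_≢ []) (cPathsF p ts)
cPathsF-nonEmpty p [] = []
cPathsF-nonEmpty p (node ch ∷ ts) = snoc≢[] p (suc (length ts)) ∷ All.++⁺ (cPathsF-nonEmpty (p ++ suc (length ts) ∷ []) ch) (cPathsF-nonEmpty p ts)

cPathsF-digits : ∀ k p ts → DigitsIn k p → length ts ≤ k → maxArityF ts ≤ k → All (DigitsIn k) (cPathsF p ts)
cPathsF-digits k p [] Dp _ _ = []
cPathsF-digits k p (node ch ∷ ts) Dp le mx =
  Dq ∷ All.++⁺ (cPathsF-digits k q ch Dq (ℕP.m⊔n≤o⇒m≤o (length ch) _ mt) (ℕP.m⊔n≤o⇒n≤o (length ch) _ mt))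
                (cPathsF-digits k p ts Dp (ℕP.≤-trans (ℕP.n≤1+n _) le) (ℕP.m⊔n≤o⇒n≤o (maxArity (node ch)) _ mx))
  where
  q : Path
  q = p ++ suc (length ts) ∷ []
  Dq : DigitsIn k q
  Dq = All.++⁺ Dp ((s≤s z≤n , le) ∷ [])
  mt : maxArity (node ch) ≤ k
  mt = ℕP.m⊔n≤o⇒m≤o (maxArity (node ch)) _ mx

length-snoc : ∀ (w : Path) c → length (w ++ c ∷ []) ≡ suc (length w)
length-snoc [] c = refl
length-snoc (x ∷ w) c = cong suc (length-snoc w c)

lex-snoc : ∀ u w c → length u ≡ length w → lexᵇ u (w ++ c ∷ []) ≡ (lexᵇ u w ∨ pathEqᵇ u w)
lex-snoc [] [] c _ = refl
lex-snoc (a ∷ u) (b ∷ w) c eq rewrite lex-snoc u w c (cong pred eq) =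
  trans (cong ((a <ᵇ b) ∨_) (∧-distribˡ-∨ (a ≡ᵇ b) (lexᵇ u w) (pathEqᵇ u w))) (sym (∨-assoc (a <ᵇ b) _ _))

pathEqᵇ-length : ∀ u w → pathEqᵇ u w ≡ true → length u ≡ length w
pathEqᵇ-length [] [] _ = refl
pathEqᵇ-length (a ∷ u) (b ∷ w) e = cong suc (pathEqᵇ-length u w (proj₂ (∧-true {a ≡ᵇ b} e)))

pathEqᵇ-sound : ∀ u w → pathEqᵇ u w ≡ true → u ≡ w
pathEqᵇ-sound [] [] _ = refl
pathEqᵇ-sound (a ∷ u) (b ∷ w) e with ∧-true {a ≡ᵇ b} e
... | e1 , e2 = cong₂ _∷_ (≡ᵇ-sound a b e1) (pathEqᵇ-sound u w e2)

pathEqᵇ-refl : ∀ u → pathEqᵇ u u ≡ true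
pathEqᵇ-refl [] = refl
pathEqᵇ-refl (a ∷ u) rewrite ≡ᵇ-refl a = pathEqᵇ-refl u

belowPathᵇ-snoc : ∀ u w c → belowPathᵇ u (w ++ c ∷ []) ≡ shortlex≤ᵇ u w
belowPathᵇ-snoc u w c rewrite length-snoc w c with length u ≡ᵇ length w in eq
... | true rewrite lex-snoc u w c (≡ᵇ-sound _ _ eq) = sym (∨-assoc (length u <ᵇ length w) (lexᵇ u w) (pathEqᵇ u w))
... | false with pathEqᵇ u w in e2
...   | true = case trans (sym eq) (≡⇒≡ᵇ-true (pathEqᵇ-length u w e2)) of λ ()
...   | false = sym (∨-identityʳ ((length u <ᵇ length w) ∨ false))

belowPathᵇ-parent : ∀ u v → v ≢ [] → belowPathᵇ u v ≡ shortlex≤ᵇ u (parent v)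
belowPathᵇ-parent u v ne = trans (cong (belowPathᵇ u) (parent-snoc⁻ v ne)) (belowPathᵇ-snoc u (parent v) (lastStep v))

lex-irrefl : ∀ u → lexᵇ u u ≡ false
lex-irrefl [] = refl
lex-irrefl (a ∷ u) rewrite <ᵇ-irrefl a | ≡ᵇ-refl a = lex-irrefl u

lex-asym : ∀ u w → lexᵇ u w ≡ true → lexᵇ w u ≡ false
lex-asym [] (b ∷ w) _ = refl
lex-asym (a ∷ u) (b ∷ w) e with ∨-true {a <ᵇ b} e
... | inj₁ lt rewrite <ᵇ-false {b} {a} (ℕP.<⇒≯ (<ᵇ-sound lt)) | ≡ᵇ-false b a (λ eq → ℕP.<-irrefl (sym eq) (<ᵇ-sound lt)) = refl
... | inj₂ p with ∧-true {a ≡ᵇ b} p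
...   | e1 , e2 with ≡ᵇ-sound a b e1
...     | refl rewrite <ᵇ-irrefl a | ≡ᵇ-refl a = lex-asym u w e2

shortlex-asym-< : ∀ a b l → a < b → ((b <ᵇ a) ∨ ((b ≡ᵇ a) ∧ l)) ≡ false
shortlex-asym-< a b l lt rewrite <ᵇ-false {b} {a} (ℕP.<⇒≯ lt) | ≡ᵇ-false b a (λ eq → ℕP.<-irrefl (sym eq) lt) = refl

shortlex-asym-≡ : ∀ a b l → a ≡ b → l ≡ false → ((b <ᵇ a) ∨ ((b ≡ᵇ a) ∧ l)) ≡ false
shortlex-asym-≡ a .a l refl e rewrite <ᵇ-irrefl a | ≡ᵇ-refl a = e

shortlex-irrefl : ∀ u → shortlexᵇ u u ≡ false
shortlex-irrefl u = shortlex-asym-≡ (length u) (length u) (lexᵇ u u) refl (lex-irrefl u)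

shortlex-asym : ∀ u w → shortlexᵇ u w ≡ true → shortlexᵇ w u ≡ false
shortlex-asym u w e with ∨-true {length u <ᵇ length w} e
... | inj₁ lt = shortlex-asym-< (length u) (length w) (lexᵇ w u) (<ᵇ-sound lt)
... | inj₂ p with ∧-true {length u ≡ᵇ length w} p
...   | e1 , e2 = shortlex-asym-≡ (length u) (length w) (lexᵇ w u) (≡ᵇ-sound _ _ e1) (lex-asym u w e2)

lookupMaybe : ∀ {A : Set} → List A → ℕ → Maybe A
lookupMaybe [] k = nothing
lookupMaybe (x ∷ xs) zero = just x
lookupMaybe (x ∷ xs) (suc k) = lookupMaybe xs k

lookupMaybe-∈ : ∀ {A : Set} (xs : List A) k {q} → lookupMaybe xs k ≡ just q → q ∈ xs
lookupMaybe-∈ (x ∷ xs) zero refl = here refl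
lookupMaybe-∈ (x ∷ xs) (suc k) e = there (lookupMaybe-∈ xs k e)

true≢false : true ≢ false
true≢false ()

shortlex≤ᵇ-false : ∀ r u → Shortlex< r u → shortlex≤ᵇ u r ≡ false
shortlex≤ᵇ-false r u s with pathEqᵇ u r in e
... | true with pathEqᵇ-sound u r e
...   | refl = ⊥-elim (true≢false (trans (sym s) (shortlex-irrefl u)))
shortlex≤ᵇ-false r u s | false rewrite shortlex-asym r u s = refl

sorted-index : ∀ r A' q → AllPairs Shortlex< (r ∷ A') → q ∈ r ∷ A' → ∀ k →
  (count (λ u → shortlex≤ᵇ u q) A' ≡ k) ⇔ (lookupMaybe (r ∷ A') k ≡ just q)
sorted-index r A' q (h ∷ ap) (here refl) k = mk⇔ (fw k) (bw k)
  where
  c0 : count (λ u → shortlex≤ᵇ u q) A' ≡ 0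
  c0 = count-none _ A' (λ u u∈ → shortlex≤ᵇ-false q u (All.lookup h u∈))
  fw : ∀ k → count (λ u → shortlex≤ᵇ u q) A' ≡ k → lookupMaybe (q ∷ A') k ≡ just q
  fw k e with trans (sym e) c0
  ... | refl = refl
  bw : ∀ k → lookupMaybe (q ∷ A') k ≡ just q → count (λ u → shortlex≤ᵇ u q) A' ≡ k
  bw zero e = c0
  bw (suc k') e = ⊥-elim (true≢false (trans (sym (All.lookup h (lookupMaybe-∈ A' k' e))) (shortlex-irrefl q)))
sorted-index r (r' ∷ A'') q (h ∷ ap) (there q∈) k = mk⇔ (fw k) (bw k)
  where
  r'≤ : ∀ {q} → q ∈ r' ∷ A'' → AllPairs Shortlex< (r' ∷ A'') → shortlex≤ᵇ r' q ≡ true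
  r'≤ {q} (here refl) _ rewrite pathEqᵇ-refl q = ∨-true⁻ {shortlexᵇ q q} (inj₂ refl)
  r'≤ (there q∈') (h' ∷ _) = ∨-true⁻ (inj₁ (All.lookup h' q∈'))
  r'≤q : shortlex≤ᵇ r' q ≡ true
  r'≤q = r'≤ q∈ ap
  IH : ∀ k → (count (λ u → shortlex≤ᵇ u q) A'' ≡ k) ⇔ (lookupMaybe (r' ∷ A'') k ≡ just q)
  IH = sorted-index r' A'' q ap q∈
  count-r' : count (λ u → shortlex≤ᵇ u q) (r' ∷ A'') ≡ suc (count (λ u → shortlex≤ᵇ u q) A'')
  count-r' = cong (_+ count (λ u → shortlex≤ᵇ u q) A'') (cong indicator r'≤q)
  fw : ∀ k → count (λ u → shortlex≤ᵇ u q) (r' ∷ A'') ≡ k → lookupMaybe (r ∷ r' ∷ A'') k ≡ just q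
  fw zero e = ⊥-elim (ℕP.1+n≢0 (trans (sym count-r') e))
  fw (suc k') e = Equivalence.to (IH k') (ℕP.suc-injective (trans (sym count-r') e))
  bw : ∀ k → lookupMaybe (r ∷ r' ∷ A'') k ≡ just q → count (λ u → shortlex≤ᵇ u q) (r' ∷ A'') ≡ k
  bw zero e with just-injective e
  ... | refl = ⊥-elim (true≢false (trans (sym (All.lookup h q∈)) (shortlex-irrefl r)))
  bw (suc k') e = trans count-r' (cong suc (Equivalence.from (IH k') e))

count-false : ∀ {A : Set} (xs : List A) → count (λ _ → false) xs ≡ 0
count-false [] = refl
count-false (x ∷ xs) = count-false xs

parent-∷ : ∀ d w → w ≢ [] → parent (d ∷ w) ≡ d ∷ parent w
parent-∷ d [] ne = ⊥-elim (ne refl)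
parent-∷ d (y ∷ w) ne = refl

count-parent-∷ : ∀ ch d c q' → count (λ w → pathEqᵇ (parent (d ∷ w)) (c ∷ q')) (cPathsF [] ch)
  ≡ count (λ w → (d ≡ᵇ c) ∧ pathEqᵇ (parent w) q') (cPathsF [] ch)
count-parent-∷ ch d c q' = count-cong (cPathsF [] ch) (λ w w∈ → cong (λ x → pathEqᵇ x (c ∷ q')) (parent-∷ d w (All.lookup (cPathsF-nonEmpty [] ch) w∈)))

count-parent-absent : ∀ ts q' → count (λ v → pathEqᵇ (parent v) (suc (length ts) ∷ q')) (cPathsF [] ts) ≡ 0
count-parent-absent ts q' = count-none _ (cPathsF [] ts) (λ v v∈ → hz v (All.lookup (cPathsF-heads ts) v∈))
  where
  hz : ∀ v → HeadIn (length ts) v → pathEqᵇ (parent v) (suc (length ts) ∷ q') ≡ false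
  hz (e' ∷ []) _ = refl
  hz (e' ∷ y ∷ v) (_ , le) rewrite ≡ᵇ-false e' (suc (length ts)) (λ eq → ℕP.<-irrefl eq (s≤s le)) = refl

count-parent-[]-∷ : ∀ cs d → count (λ w → pathEqᵇ (parent (d ∷ w)) []) (cPathsF [] cs) ≡ 0
count-parent-[]-∷ cs d = count-none _ (cPathsF [] cs) (λ w w∈ → cong (λ x → pathEqᵇ x []) (parent-∷ d w (All.lookup (cPathsF-nonEmpty [] cs) w∈)))

mutual
  arity≡childCount : ∀ ts q → arity (node ts) q ≡ count (λ v → pathEqᵇ (parent v) q) (cPathsF [] ts)
  arity≡childCount ts [] = rootArity≡childCount ts
  arity≡childCount ts (c ∷ q') = arityF≡childCount ts c q'

  rootArity≡childCount : ∀ ts → length ts ≡ count (λ v → pathEqᵇ (parent v) []) (cPathsF [] ts)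
  rootArity≡childCount [] = refl
  rootArity≡childCount (node cs ∷ ts) = cong suc (trans (rootArity≡childCount ts) (sym step))
    where
    Q : Path → Bool
    Q = λ v → pathEqᵇ (parent v) []
    step : count Q (cPathsF (suc (length ts) ∷ []) cs ++ cPathsF [] ts) ≡ count Q (cPathsF [] ts)
    step = trans (count-++ Q (cPathsF (suc (length ts) ∷ []) cs) (cPathsF [] ts))
      (cong (_+ count Q (cPathsF [] ts)) (trans (cong (count Q) (cPathsF-prefix (suc (length ts) ∷ []) cs))
        (trans (count-map Q (suc (length ts) ∷_) (cPathsF [] cs)) (count-parent-[]-∷ cs (suc (length ts))))))

  arityF≡childCount : ∀ ts c q' → arityF ts c q' ≡ count (λ v → pathEqᵇ (parent v) (c ∷ q')) (cPathsF [] ts)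
  arityF≡childCount [] c q' = refl
  arityF≡childCount (node cs ∷ ts) c q' = trans (fin (c ≡ᵇ d) refl) (sym split)
    where
    d : ℕ
    d = suc (length ts)
    Q : Path → Bool
    Q = λ v → pathEqᵇ (parent v) (c ∷ q')
    split : count Q (cPathsF [] (node cs ∷ ts)) ≡ count (λ w → (d ≡ᵇ c) ∧ pathEqᵇ (parent w) q') (cPathsF [] cs) + count Q (cPathsF [] ts)
    split = trans (count-++ Q (cPathsF (d ∷ []) cs) (cPathsF [] ts))
      (cong (_+ count Q (cPathsF [] ts)) (trans (cong (count Q) (cPathsF-prefix (d ∷ []) cs))
        (trans (count-map Q (d ∷_) (cPathsF [] cs)) (count-parent-∷ cs d c q'))))
    fin : ∀ b → (c ≡ᵇ d) ≡ b → arityF (node cs ∷ ts) c q' ≡ count (λ w → (d ≡ᵇ c) ∧ pathEqᵇ (parent w) q') (cPathsF [] cs) + count Q (cPathsF [] ts)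
    fin true e with ≡ᵇ-sound c d e
    ... | refl rewrite ≡ᵇ-refl d | count-parent-absent ts q' = trans (arity≡childCount cs q') (sym (ℕP.+-identityʳ _))
    fin false e rewrite e | ≡ᵇ-false d c (λ eq → true≢false (trans (sym (≡⇒≡ᵇ-true (sym eq))) e)) | count-false (cPathsF [] cs) = arityF≡childCount ts c q'

map-lookup-range : ∀ {A : Set} (f : A → ℕ) (g : ℕ → ℕ) (xs : List A) s →
  (∀ k q → lookupMaybe xs k ≡ just q → g (s + k) ≡ f q) → map f xs ≡ map g (range s (length xs))
map-lookup-range f g [] s h = refl
map-lookup-range f g (x ∷ xs) s h = cong₂ _∷_ (sym (trans (cong g (sym (ℕP.+-identityʳ s))) (h 0 x refl)))
  (map-lookup-range f g xs (suc s) (λ k q e → trans (cong g (sym (ℕP.+-suc s k))) (h (suc k) q e)))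

degreeCountTree : List PTree → ℕ → ℕ
degreeCountTree ts k = count (λ v → count (λ u → belowPathᵇ u v) (cPathsF [] ts) ≡ᵇ k) (cPathsF [] ts)

-- A non-root node v is above exactly the nodes weakly before its parent in bounce order,
-- so its down-degree is the position of its parent there.
module BounceOrderDegrees (ts : List PTree) where
  nodes nonRoot : List Path
  nodes = cPathsF [] ts
  nonRoot = concat (map reverse (pathLevelsF ts))

  nonRoot-↭ : nonRoot ↭ nodes
  nonRoot-↭ = ↭-trans (concat-reverse-↭ (pathLevelsF ts)) (pathLevelsF-↭ ts)

  module _ (v : Path) (v∈ : v ∈ nodes) where
    below-count : count (λ u → belowPathᵇ u v) nodes ≡ count (λ u → shortlex≤ᵇ u (parent v)) nonRoot
    below-count = trans (count-cong nodes (λ u _ → belowPathᵇ-parent u v (All.lookup (cPathsF-nonEmpty [] ts) v∈)))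
                        (sym (count-↭ _ nonRoot-↭))

    position-parent : ∀ k → (count (λ u → belowPathᵇ u v) nodes ≡ k) ⇔ (lookupMaybe ([] ∷ nonRoot) k ≡ just (parent v))
    position-parent k = mk⇔ (λ e → Equivalence.to I (trans (sym below-count) e)) (λ e → trans below-count (Equivalence.from I e))
      where
      I : (count (λ u → shortlex≤ᵇ u (parent v)) nonRoot ≡ k) ⇔ (lookupMaybe ([] ∷ nonRoot) k ≡ just (parent v))
      I = sorted-index [] nonRoot (parent v) (bounceOrder-sorted (node ts))
            (↭.∈-resp-↭ (prep [] (↭-sym nonRoot-↭)) (parent-closed [] ts v v∈)) k

  degreeCountTree-lookup : ∀ k q → lookupMaybe ([] ∷ nonRoot) k ≡ just q → degreeCountTree ts k ≡ arity (node ts) q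
  degreeCountTree-lookup k q lk = trans (count-cong nodes hasParent) (sym (arity≡childCount ts q))
    where
    hasParent : ∀ v → v ∈ nodes → (count (λ u → belowPathᵇ u v) nodes ≡ᵇ k) ≡ pathEqᵇ (parent v) q
    hasParent v v∈ = bool-ext
      (λ e → case just-injective (trans (sym lk) (Equivalence.to (position-parent v v∈ k) (≡ᵇ-sound _ _ e))) of λ
        { refl → pathEqᵇ-refl q })
      (λ e → case pathEqᵇ-sound (parent v) q e of λ
        { refl → ≡⇒≡ᵇ-true (Equivalence.from (position-parent v v∈ k) lk) })

bounceCounts≡degreeCounts : ∀ ts → bounceCounts (node ts) ≡ map (degreeCountTree ts) (range 0 (suc (sizeF ts)))
bounceCounts≡degreeCounts ts = begin
  bounceCounts (node ts)                                                   ≡⟨ bounceCounts≡arities (node ts) ⟩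
  map (arity (node ts)) (bounceOrder (node ts))                            ≡⟨ map-lookup-range _ _ (bounceOrder (node ts)) 0
                                                                                (BounceOrderDegrees.degreeCountTree-lookup ts) ⟩
  map (degreeCountTree ts) (range 0 (length (bounceOrder (node ts))))      ≡⟨ cong (map (degreeCountTree ts) ∘ range 0) (length-bounceOrder (node ts)) ⟩
  map (degreeCountTree ts) (range 0 (suc (sizeF ts)))                      ∎
  where open ≡-Reasoning

module XiPosetDegrees (ts : List PTree) where
  m : ℕ
  m = maxArity (node ts)

  nodes : List Path
  nodes = cPathsF [] ts

  coords : List ℚ
  coords = map (xCoord m) nodes

  length-XiPosetSet : length (XiPosetSet (node ts)) ≡ sizeF ts
  length-XiPosetSet = trans (↭.↭-length (sort-↭ coords)) (trans (List.length-map (xCoord m) nodes) (length-cPathsF ts))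

  nodes-digits : All (DigitsIn m) nodes
  nodes-digits = cPathsF-digits m [] ts [] (ℕP.m≤m⊔n (length ts) _) (ℕP.m≤n⊔m (length ts) _)

  downDegree-xCoord : ∀ v → v ∈ nodes → downDegree coords (xCoord m v) ≡ count (λ u → belowPathᵇ u v) nodes
  downDegree-xCoord v v∈ = trans (count-map _ (xCoord m) nodes)
    (count-cong nodes (λ u u∈ → Digits.xCoord-below m u v (All.lookup nodes-digits u∈) (All.lookup nodes-digits v∈)))

  degreeCount-XiPosetSet : ∀ k → degreeCount (XiPosetSet (node ts)) k ≡ degreeCountTree ts k
  degreeCount-XiPosetSet k = begin
    degreeCount X k                                ≡⟨ degreeCount-downDegrees X k ⟩
    count (λ b → b ≡ᵇ k) (map (downDegree X) X)    ≡⟨ count-map _ (downDegree X) X ⟩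
    count (λ x → downDegree X x ≡ᵇ k) X            ≡⟨ count-cong X (λ x _ → cong (_≡ᵇ k) (count-↭ _ (sort-↭ coords))) ⟩
    count (λ x → downDegree coords x ≡ᵇ k) X       ≡⟨ count-↭ _ (sort-↭ coords) ⟩
    count (λ x → downDegree coords x ≡ᵇ k) coords  ≡⟨ count-map _ (xCoord m) nodes ⟩
    count (λ v → downDegree coords (xCoord m v) ≡ᵇ k) nodes
                                                   ≡⟨ count-cong nodes (λ v v∈ → cong (_≡ᵇ k) (downDegree-xCoord v v∈)) ⟩
    degreeCountTree ts k                           ∎
    where
    open ≡-Reasoning
    X : List ℚ
    X = XiPosetSet (node ts)

  degreeWord-XiPosetSet : degreeWord (XiPosetSet (node ts)) ≡ XiBounce (node ts)
  degreeWord-XiPosetSet = begin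
    joinE (map (λ k → replicate (degreeCount X k) N) (range 0 (suc (length X))))
      ≡⟨ cong (λ l → joinE (map (λ k → replicate (degreeCount X k) N) (range 0 (suc l)))) length-XiPosetSet ⟩
    joinE (map (λ k → replicate (degreeCount X k) N) (range 0 (suc (sizeF ts))))
      ≡⟨ cong joinE (List.map-cong (λ k → cong (λ a → replicate a N) (degreeCount-XiPosetSet k)) (range 0 (suc (sizeF ts)))) ⟩
    joinE (map (λ k → replicate (degreeCountTree ts k) N) (range 0 (suc (sizeF ts))))
      ≡⟨ cong joinE (List.map-∘ (range 0 (suc (sizeF ts)))) ⟩
    joinE (map (λ a → replicate a N) (map (degreeCountTree ts) (range 0 (suc (sizeF ts)))))
      ≡⟨ cong (joinE ∘ map (λ a → replicate a N)) (bounceCounts≡degreeCounts ts) ⟨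
    XiBounce (node ts) ∎
    where
    open ≡-Reasoning
    X : List ℚ
    X = XiPosetSet (node ts)

phiWord∘XiPoset : ∀ T S → Good S → PosetIso S (XiPosetSet T) → phiWord S ≡ XiBounce T
phiWord∘XiPoset (node ts) S good iso = begin
  phiWord S                        ≡⟨ phiWord≡degreeWord S good ⟩
  degreeWord S                     ≡⟨ IsoInvariance.degreeWord-preserved S (XiPosetSet (node ts)) iso ⟩
  degreeWord (XiPosetSet (node ts)) ≡⟨ XiPosetDegrees.degreeWord-XiPosetSet ts ⟩
  XiBounce (node ts)               ∎
  where open ≡-Reasoning

proposition4p2 : (n : ℕ) → n ≥ 1 →
    ((T : PTree) → size T ≡ n →
      (S : List ℚ) → Good S → PosetIso S (XiPosetSet T) →
      phiWord S ≡ XiBounce T)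
    ×
    ((S : List ℚ) → Good S → length S ≡ n → IsDyck n (phiWord S))
    ×
    ((S S' : List ℚ) → Good S → Good S' → PosetIso S S' →
      phiWord S ≡ phiWord S')
    ×
    ((S S' : List ℚ) → Good S → Good S' → length S ≡ n → length S' ≡ n →
      phiWord S ≡ phiWord S' → PosetIso S S')
    ×
    ((w : List Step) → IsDyck n w →
      Σ (List ℚ) (λ S → Good S × length S ≡ n × phiWord S ≡ w))
proposition4p2 n _ =
  (λ T _ → phiWord∘XiPoset T) ,
  phiWord-isDyck n ,
  phiWord-isoInvariant ,
  (λ S S' good good' |S| |S'| → phiWord-injective S S' good good' (trans |S| (sym |S'|))) ,
  phiWord-surjective n
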